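{- Let $M$ be a loopless matroid of rank $n \geq 1$ with lattice of flats $\mathcal{L}(M)$, and let $\lambda$ be an $R$-labeling of $\mathcal{L}(M)$ with nonnegative integer values. Then the Chow polynomial of $M$ satisfies \[ \underline{\mathsf{H}}_M(x) = \sum_{\mathcal{F}} x^{\mathsf{des}(\mathcal{F})} (x+1)^{n-1-2\,\mathsf{des}(\mathcal{F})}, \] where the sum ranges over all maximal chains $\mathcal{F}$ in $\mathcal{L}(M)$ such that $\mathsf{Des}(\mathcal{F})$ is isolated and $1 \notin \mathsf{Des}(\mathcal{F})$.
   Context: For a finite graded poset $P$ of rank $n$ (unique minimum $\hat 0$, unique maximum $\hat 1$), with Möbius function $\mu$, the characteristic polynomial is $\chi_P(q) = \sum_{F \in P} \mu(\hat 0, F) q^{n - \mathsf{rank}(F)}$ and the reduced characteristic polynomial is $\overline{\chi}_P(q) = \chi_P(q)/(q-1)$ (for $n\ge 1$). For a chain $\mathcal{C} = \{\mathcal{C}_1 < \dots < \mathcal{C}_{k+1}\}$ set $\overline{\chi}_{P,\mathcal{C}}(q) = \prod_{i=1}^k \overline{\chi}_{[\mathcal{C}_i, \mathcal{C}_{i+1}]}(q)$. The Chow polynomial $\underline{\mathsf{H}}_M(x)$ of $M$ is the Hilbert–Poincaré series of the Chow ring of $M$; equivalently, with $P = \mathcal{L}(M)$, it equals $\sum_{\mathcal{C}} \overline{\chi}_{P,\mathcal{C}}(x)$, the sum over all chains $\mathcal{C} = \{\mathcal{C}_1 < \dots < \mathcal{C}_{k+1}\}$ ($k \geq 1$) in $P$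 with $\mathcal{C}_1 = \hat 0$ and $\mathcal{C}_{k+1} = \hat 1$. An $R$-labeling of a finite graded poset is a labeling $\lambda$ of its cover relations such that every interval contains a unique maximal chain along which the labels are weakly increasing. For a maximal chain $\mathcal{F} = \{\mathcal{F}_0 \prec \mathcal{F}_1 \prec \dots \prec \mathcal{F}_n\}$ put $\lambda_i = \lambda(\mathcal{F}_{i-1} \prec \mathcal{F}_i)$, $\mathsf{Des}(\mathcal{F}) = \{ i \in \{1,\dots,n-1\} \mid \lambda_i > \lambda_{i+1}\}$ and $\mathsf{des}(\mathcal{F}) = |\mathsf{Des}(\mathcal{F})|$. The set $\mathsf{Des}(\mathcal{F})$ is called isolated if $i \in \mathsf{Des}(\mathcal{F})$ implies $i+1 \notin \mathsf{Des}(\mathcal{F})$. -}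

module Defs where

open import Data.Nat as ℕ using (ℕ; zero; suc; _+_; _∸_; _≤_; _<_; _≤?_; _<?_)
open import Data.Integer as ℤ using (ℤ; +_)
open import Data.Bool using (Bool; true; false)
import Data.Bool
import Data.Vec.Properties
import Data.List.Relation.Unary.All
open import Data.Fin using (Fin)
open import Data.Fin.Properties using (all?; any?)
open import Data.Fin.Subset
  using (Subset; _∈_; _∉_; _⊆_; _⊂_; _∪_; _∩_; ⊥; ⊤; ⁅_⁆; ∣_∣; inside; outside)
open import Data.Fin.Subset.Properties using (_∈?_)
open import Data.Vec using (Vec; []; _∷_)
open import Data.List as List using (List; []; _∷_; _++_; [_]; map; filter; concatMap; length; replicate; upTo)
open import Data.List.Relation.Unary.All using (All)
open import Data.List.Relation.Unary.Linked using (Linked; linked?)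
import Data.List.Membership.DecPropositional as DecMem
open import Data.Product using (Σ; ∃; _×_; _,_; proj₁; proj₂)
open import Relation.Nullary using (Dec; yes; no; ¬_; map′; ¬?; _×-dec_; _→-dec_)
open import Relation.Binary.PropositionalEquality using (_≡_; _≢_)

-- Matroids on the ground set Fin m, given by their rank function
-- (rank axioms R1–R3 of Oxley).

record Matroid (m : ℕ) : Set where
  field
    r         : Subset m → ℕ
    r-bounded : ∀ X → r X ≤ ∣ X ∣
    r-mono    : ∀ {X Y} → X ⊆ Y → r X ≤ r Y
    r-submod  : ∀ X Y → r (X ∪ Y) + r (X ∩ Y) ≤ r X + r Y

open Matroid public

rank : ∀ {m} → Matroid m → ℕ
rank M = r M ⊤

Loopless : ∀ {m} → Matroid m → Set
Loopless {m} M = ∀ (e : Fin m) → r M ⁅ e ⁆ ≡ 1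

IsFlat : ∀ {m} → Matroid m → Subset m → Set
IsFlat {m} M F = ∀ (e : Fin m) → e ∉ F → r M F < r M (F ∪ ⁅ e ⁆)

_⊆?_ : ∀ {m} (p q : Subset m) → Dec (p ⊆ q)
p ⊆? q = map′ (λ h {x} → h x) (λ h x → h {x}) (all? (λ x → (x ∈? p) →-dec (x ∈? q)))

_⊂?_ : ∀ {m} (p q : Subset m) → Dec (p ⊂ q)
p ⊂? q = (p ⊆? q) ×-dec any? (λ x → (x ∈? q) ×-dec ¬? (x ∈? p))

isFlat? : ∀ {m} (M : Matroid m) (F : Subset m) → Dec (IsFlat M F)
isFlat? M F = all? (λ e → ¬? (e ∈? F) →-dec (r M F <? r M (F ∪ ⁅ e ⁆)))

allSub? : ∀ {m} {P : Subset m → Set} → (∀ c → Dec (P c)) → Dec (∀ c → P c)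
allSub? {zero} P? with P? []
... | yes p = yes λ { [] → p }
... | no ¬p = no λ h → ¬p (h [])
allSub? {suc m} {P} P? with allSub? (λ c → P? (inside ∷ c)) | allSub? (λ c → P? (outside ∷ c))
... | yes h₁ | yes h₂ = yes λ { (true ∷ c) → h₁ c ; (false ∷ c) → h₂ c }
... | no ¬h | _ = no λ h → ¬h (λ c → h (inside ∷ c))
... | yes _ | no ¬h = no λ h → ¬h (λ c → h (outside ∷ c))

allSubsets : ∀ m → List (Subset m)
allSubsets zero    = [] ∷ []
allSubsets (suc m) = map (inside ∷_) (allSubsets m) ++ map (outside ∷_) (allSubsets m)

listsOfLength : ∀ {A : Set} → List A → ℕ → List (List A)
listsOfLength xs zero    = [] ∷ []
listsOfLength xs (suc L) = concatMap (λ x → map (x ∷_) (listsOfLength xs L)) xs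

flats : ∀ {m} → Matroid m → List (Subset m)
flats {m} M = filter (isFlat? M) (allSubsets m)

-- candidate chains from ⊥ to ⊤: lists ⊥ ∷ mid ++ [ ⊤ ], mid of length ≤ m.
-- (Any strict chain of subsets of Fin m has at most m+1 elements, so this
-- covers every chain from ⊥ to ⊤; each list appears once.)
candidates : ∀ m → List (List (Subset m))
candidates m =
  concatMap (λ L → map (λ mid → ⊥ ∷ mid ++ [ ⊤ ]) (listsOfLength (allSubsets m) L)) (upTo (suc m))

-- Polynomials with integer coefficients: coefficient lists, constant term first

Poly : Set
Poly = List ℤ

_+ₚ_ : Poly → Poly → Poly
[]      +ₚ q       = q
(a ∷ p) +ₚ []      = a ∷ p
(a ∷ p) +ₚ (b ∷ q) = (a ℤ.+ b) ∷ (p +ₚ q)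

_*ₚ_ : Poly → Poly → Poly
[]      *ₚ q = []
(a ∷ p) *ₚ q = map (a ℤ.*_) q +ₚ (+ 0 ∷ (p *ₚ q))

sumₚ : List Poly → Poly
sumₚ = List.foldr _+ₚ_ []

prodₚ : List Poly → Poly
prodₚ = List.foldr _*ₚ_ (+ 1 ∷ [])

_^ₚ_ : Poly → ℕ → Poly
p ^ₚ zero  = + 1 ∷ []
p ^ₚ suc k = p *ₚ (p ^ₚ k)

monomial : ℤ → ℕ → Poly
monomial c k = replicate k (+ 0) ++ [ c ]

X X+1 : Poly
X   = + 0 ∷ + 1 ∷ []
X+1 = + 1 ∷ + 1 ∷ []

coeff : Poly → ℕ → ℤ
coeff []      k       = + 0
coeff (a ∷ p) zero    = a
coeff (a ∷ p) (suc k) = coeff p k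

_≈ₚ_ : Poly → Poly → Set
p ≈ₚ q = ∀ k → coeff p k ≡ coeff q k

-- quotient of p = Σ aᵢ qⁱ (degree ≤ d) by (q - 1) via synthetic division:
-- the quotient has coefficients bᵢ = -(a₀ + … + aᵢ), i = 0 … d-1
-- (exact whenever p(1) = 0).
divByQ-1 : Poly → Poly
divByQ-1 = go (+ 0)
  where
  go : ℤ → Poly → Poly
  go s []            = []
  go s (a ∷ [])      = []
  go s (a ∷ b ∷ as)  = ℤ.- (s ℤ.+ a) ∷ go (s ℤ.+ a) (b ∷ as)

sumℤ : List ℤ → ℤ
sumℤ = List.foldr ℤ._+_ (+ 0)

-- Lattice of flats L(M), ordered by inclusion.  For loopless M its
-- minimum is ⊥ (= closure of ∅) and its maximum is ⊤ (the ground set).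

module _ {m : ℕ} (M : Matroid m) where

  -- Möbius function of L(M), by the usual recursion
  --   μ(a,a) = 1,  μ(a,b) = - Σ_{a ≤ c < b} μ(a,c)  (a < b),  μ(a,b) = 0 otherwise,
  -- computed with a fuel argument (fuel m+1 exceeds the length of every chain).
  möbiusFuel : ℕ → Subset m → Subset m → ℤ
  möbiusFuel zero     a b = + 0
  möbiusFuel (suc f)  a b with Data.Vec.Properties.≡-dec Data.Bool._≟_ a b
  ... | yes _ = + 1
  ... | no  _ with a ⊆? b
  ...   | no  _ = + 0
  ...   | yes _ = ℤ.- sumℤ (map (möbiusFuel f a)
                               (filter (λ c → (a ⊆? c) ×-dec (c ⊂? b)) (flats M)))

  μ : Subset m → Subset m → ℤ
  μ = möbiusFuel (suc m)

  -- characteristic polynomial of the interval [a,b] (a graded poset of rank r b - r a,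
  -- in which F has rank r F - r a):  χ(q) = Σ_{F ∈ [a,b]} μ(a,F) q^{r b - r F}
  charPoly : Subset m → Subset m → Poly
  charPoly a b = sumₚ (map (λ F → monomial (μ a F) (r M b ∸ r M F))
                           (filter (λ F → (a ⊆? F) ×-dec (F ⊆? b)) (flats M)))

  redCharPoly : Subset m → Subset m → Poly
  redCharPoly a b = divByQ-1 (charPoly a b)

  steps : ∀ {A : Set} → List A → List (A × A)
  steps []           = []
  steps (x ∷ [])     = []
  steps (x ∷ y ∷ xs) = (x , y) ∷ steps (y ∷ xs)

  -- chains C₁ < … < C_{k+1} (k ≥ 1) in L(M) with C₁ = 0̂ = ⊥ and C_{k+1} = 1̂ = ⊤
  IsFlagChain : List (Subset m) → Set
  IsFlagChain C = All (IsFlat M) C × Linked _⊂_ C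

  flagChains : List (List (Subset m))
  flagChains = filter (λ C → Data.List.Relation.Unary.All.all? (isFlat? M) C ×-dec linked? _⊂?_ C)
                      (candidates m)

  chowPoly : Poly
  chowPoly = sumₚ (map (λ C → prodₚ (map (λ { (a , b) → redCharPoly a b }) (steps C))) flagChains)

  Cover : Subset m → Subset m → Set
  Cover a b = IsFlat M a × IsFlat M b × a ⊂ b × (∀ c → IsFlat M c → a ⊂ c → ¬ (c ⊂ b))

  cover? : ∀ a b → Dec (Cover a b)
  cover? a b = isFlat? M a ×-dec isFlat? M b ×-dec (a ⊂? b) ×-dec
               allSub? (λ c → isFlat? M c →-dec (a ⊂? c) →-dec ¬? (c ⊂? b))

  MaxChainOf : Subset m → Subset m → List (Subset m) → Set
  MaxChainOf a b C = Σ (List (Subset m)) (λ mid → C ≡ a ∷ mid ++ [ b ]) × Linked Cover C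

  maximalChains : List (List (Subset m))
  maximalChains = filter (linked? cover?) (candidates m)

  module _ (lab : Subset m → Subset m → ℕ) where

    labels : List (Subset m) → List ℕ
    labels C = map (λ { (a , b) → lab a b }) (steps C)

    WeaklyIncreasing : List (Subset m) → Set
    WeaklyIncreasing C = Linked _≤_ (labels C)

  IsRLabeling : (Subset m → Subset m → ℕ) → Set
  IsRLabeling lab =
    ∀ a b → IsFlat M a → IsFlat M b → a ⊂ b →
      Σ (List (Subset m)) λ C →
        (MaxChainOf a b C × WeaklyIncreasing lab C) ×
        (∀ C′ → MaxChainOf a b C′ → WeaklyIncreasing lab C′ → C′ ≡ C)

-- descent set of a label sequence λ₁ … λ_k :  { i ∈ {1,…,k-1} | λ_i > λ_{i+1} }
descentsFrom : ℕ → List ℕ → List ℕ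
descentsFrom i []       = []
descentsFrom i (x ∷ xs) = go i x xs
  where
  go : ℕ → ℕ → List ℕ → List ℕ
  go i x []       = []
  go i x (y ∷ ys) with y <? x
  ... | yes _ = i ∷ go (suc i) y ys
  ... | no  _ = go (suc i) y ys

Des : ∀ {m} (M : Matroid m) (lab : Subset m → Subset m → ℕ) → List (Subset m) → List ℕ
Des M lab F = descentsFrom 1 (labels M lab F)

des : ∀ {m} (M : Matroid m) (lab : Subset m → Subset m → ℕ) → List (Subset m) → ℕ
des M lab F = length (Des M lab F)

open DecMem ℕ._≟_ using () renaming (_∈_ to _∈ₗ_; _∉_ to _∉ₗ_; _∉?_ to _∉ₗ?_)

GoodDes : List ℕ → Set
GoodDes D = All (λ i → suc i ∉ₗ D) D × 1 ∉ₗ D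

goodDes? : ∀ D → Dec (GoodDes D)
goodDes? D = Data.List.Relation.Unary.All.all? (λ i → suc i ∉ₗ? D) D ×-dec (1 ∉ₗ? D)

descentSum : ∀ {m} (M : Matroid m) (lab : Subset m → Subset m → ℕ) → Poly
descentSum M lab =
  sumₚ (map (λ F → (X ^ₚ des M lab F) *ₚ (X+1 ^ₚ (rank M ∸ 1 ∸ 2 ℕ.* des M lab F)))
            (filter (λ F → goodDes? (Des M lab F)) (maximalChains M)))

{-# OPTIONS --safe #-}
module Submission where

-- Both sides are sums over maximal chains of L(M), each chain weighted through its label word.
-- For an R-labeling, μ(a, c) is the signed number of chains of [a, c] with strictly decreasing
-- labels and [c, b] has exactly one chain with increasing labels; splitting chains at c gives
-- χ̄_[a,b] as a sum over maximal chains of a weight of the label word (redCharWeight). Refining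
-- every flag chain into the maximal chains through it, the Chow polynomial becomes a sum over
-- maximal chains of the sum, over all cuttings of the label word into consecutive blocks, of the
-- product of the block weights; induction on the word shows that this equals
-- x^des (x + 1)^(n - 1 - 2 des) when the descent set is isolated and avoids 1, and 0 otherwise.

open import Defs
open import Data.Nat using (ℕ; _≤_)
open import Data.Fin.Subset using (Subset)

open import Algebra.Bundles using (CommutativeMonoid; CommutativeRing)
open import Data.Bool using (Bool; true; false; _∧_; if_then_else_)
import Data.Bool as Bool
open import Data.Bool.Properties using (∧-identityʳ; ∧-commutativeMonoid)
open import Algebra.Properties.CommutativeSemigroup (CommutativeMonoid.commutativeSemigroup ∧-commutativeMonoid)
  using () renaming (interchange to ∧-interchange)
open import Data.Fin using (Fin; fromℕ<)
import Data.Fin as Fin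
open import Data.Fin.Properties using (any?)
open import Data.Fin.Subset using (inside; outside; _∈_; _⊆_; _⊂_; _∪_; _∩_; _-_; ⊥; ⊤; ⁅_⁆; ∣_∣)
open import Data.Fin.Subset.Properties
  using ( _∈?_; ∈⊤; ∉⊥; ⊆⊤; ⊆-antisym; ⊂-irref; ⊂-trans; p⊆p∪q; q⊆p∪q; x∈p∪q⁻; x∈p∩q⁺; x∈⁅x⁆; x∈⁅y⁆⇒x≡y
        ; ∣⊥∣≡0; ∣⊤∣≡n; ∣⁅x⁆∣≡1; ∣p∣≤n; nonempty?; Empty-unique; x∈p⇒∣p-x∣<∣p∣; p─q⊆p; x∈p∧x≢y⇒x∈p-y)
open import Data.Integer as ℤ using (ℤ; +_)
import Data.Integer.Properties as ℤP
open import Data.Integer.Tactic.RingSolver using (solve-∀)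
open import Data.List using (List; []; _∷_; _++_; [_]; length; map; concatMap; filter; upTo; applyUpTo)
import Data.List.Properties as List
open import Data.List.Properties using (length-map; map-applyUpTo)
open import Data.List.Membership.Propositional.Properties using (∈-map⁺; ∈-map⁻)
open import Data.List.Relation.Unary.All using (All; _∷_)
import Data.List.Relation.Unary.All as All
import Data.List.Relation.Unary.All.Properties as All
open import Data.List.Relation.Unary.Any using (here; there)
open import Data.List.Relation.Unary.Linked using (Linked; linked?; _∷_)
open import Data.Maybe using (nothing)
open import Data.Nat as ℕ using (zero; suc; _+_; _∸_; _<_; _≤?_; _<?_; s≤s; z≤n)
import Data.Nat.Properties as ℕP
open import Data.Nat.Properties using (_>?_)
open import Data.List.Membership.DecPropositional ℕ._≟_
  using () renaming (_∈_ to _∈ₗ_; _∉_ to _∉ₗ_; _∉?_ to _∉ₗ?_)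
open import Data.Product using (_,_; proj₁; _×_)
open import Data.Sum using (inj₁; inj₂)
open import Data.Vec using ([]; _∷_; tabulate)
import Data.Vec.Properties as Vec
open import Data.Vec.Properties using (lookup∘tabulate; []=⇒lookup; lookup⇒[]=)
open import Function using (id; _∘_; _⇔_; mk⇔; Equivalence)
open import Level using (0ℓ)
open import Relation.Binary.Bundles using (Setoid)
open import Relation.Binary.Definitions using (DecidableEquality)
open import Relation.Binary.PropositionalEquality hiding ([_])
import Relation.Binary.Reasoning.Setoid as SetoidReasoning
open import Relation.Nullary using (Dec; yes; no; does; proof; ¬_; ¬?; _×-dec_; contradiction)
open import Relation.Nullary.Decidable using (dec-true; dec-false; does-⇔)
open import Relation.Nullary.Reflects using (Reflects; invert)
open import Relation.Unary using (Decidable)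
import Tactic.RingSolver as PolySolver
import Tactic.RingSolver.Core.AlmostCommutativeRing as ACR

-- Polynomials are equal when their coefficients are; the record makes both
-- sides inferable, which the function type _≈ₚ_ is not.
infix 4 _≈_
record _≈_ (p q : Poly) : Set where
  constructor coeffwise
  field coeff-≡ : p ≈ₚ q
open _≈_ public

≈-refl : ∀ {p} → p ≈ p
≈-refl = coeffwise λ _ → refl

≈-reflexive : ∀ {p q} → p ≡ q → p ≈ q
≈-reflexive refl = ≈-refl

≈-sym : ∀ {p q} → p ≈ q → q ≈ p
≈-sym p≈q = coeffwise λ k → sym (coeff-≡ p≈q k)

≈-trans : ∀ {p q s} → p ≈ q → q ≈ s → p ≈ s
≈-trans p≈q q≈s = coeffwise λ k → trans (coeff-≡ p≈q k) (coeff-≡ q≈s k)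

≈-setoid : Setoid 0ℓ 0ℓ
≈-setoid = record
  { Carrier = Poly ; _≈_ = _≈_
  ; isEquivalence = record { refl = ≈-refl ; sym = ≈-sym ; trans = ≈-trans } }

module ≈-Reasoning = SetoidReasoning ≈-setoid

-- Defs gives _+ₚ_ and _*ₚ_ the default non-associative fixity 20, hence 21 here.
infix  21 -ₚ_
infixr 21 _·ₚ_

-ₚ_ : Poly → Poly
-ₚ p = map (ℤ.-_) p

_·ₚ_ : ℤ → Poly → Poly
a ·ₚ p = map (a ℤ.*_) p

0ₚ 1ₚ : Poly
0ₚ = []
1ₚ = + 1 ∷ []

coeff-+ₚ : ∀ p q k → coeff (p +ₚ q) k ≡ coeff p k ℤ.+ coeff q k
coeff-+ₚ []      q       k       = sym (ℤP.+-identityˡ _)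
coeff-+ₚ (a ∷ p) []      k       = sym (ℤP.+-identityʳ _)
coeff-+ₚ (a ∷ p) (b ∷ q) zero    = refl
coeff-+ₚ (a ∷ p) (b ∷ q) (suc k) = coeff-+ₚ p q k

coeff-·ₚ : ∀ a p k → coeff (a ·ₚ p) k ≡ a ℤ.* coeff p k
coeff-·ₚ a []      k       = sym (ℤP.*-zeroʳ a)
coeff-·ₚ a (b ∷ p) zero    = refl
coeff-·ₚ a (b ∷ p) (suc k) = coeff-·ₚ a p k

coeff-negₚ : ∀ p k → coeff (-ₚ p) k ≡ ℤ.- coeff p k
coeff-negₚ []      k       = refl
coeff-negₚ (b ∷ p) zero    = refl
coeff-negₚ (b ∷ p) (suc k) = coeff-negₚ p k

∷-cong : ∀ {a b p q} → a ≡ b → p ≈ q → a ∷ p ≈ b ∷ q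
∷-cong a≡b p≈q = coeffwise λ { zero → a≡b ; (suc k) → coeff-≡ p≈q k }

∷-congʳ : ∀ a {p q} → p ≈ q → a ∷ p ≈ a ∷ q
∷-congʳ a = ∷-cong refl

∷-injectiveˡ : ∀ {a b p q} → a ∷ p ≈ b ∷ q → a ≡ b
∷-injectiveˡ a∷p≈b∷q = coeff-≡ a∷p≈b∷q zero

∷-injectiveʳ : ∀ {a b p q} → a ∷ p ≈ b ∷ q → p ≈ q
∷-injectiveʳ a∷p≈b∷q = coeffwise λ k → coeff-≡ a∷p≈b∷q (suc k)

+ₚ-assoc : ∀ p q s → (p +ₚ q) +ₚ s ≡ p +ₚ (q +ₚ s)
+ₚ-assoc []      q       s       = refl
+ₚ-assoc (a ∷ p) []      s       = refl
+ₚ-assoc (a ∷ p) (b ∷ q) []      = refl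
+ₚ-assoc (a ∷ p) (b ∷ q) (c ∷ s) = cong₂ _∷_ (ℤP.+-assoc a b c) (+ₚ-assoc p q s)

+ₚ-comm : ∀ p q → p +ₚ q ≡ q +ₚ p
+ₚ-comm []      []      = refl
+ₚ-comm []      (b ∷ q) = refl
+ₚ-comm (a ∷ p) []      = refl
+ₚ-comm (a ∷ p) (b ∷ q) = cong₂ _∷_ (ℤP.+-comm a b) (+ₚ-comm p q)

+ₚ-identityʳ : ∀ p → p +ₚ [] ≡ p
+ₚ-identityʳ []      = refl
+ₚ-identityʳ (a ∷ p) = refl

-ₚ‿inverseˡ : ∀ p → (-ₚ p) +ₚ p ≈ 0ₚ
-ₚ‿inverseˡ p = coeffwise λ k → begin
  coeff ((-ₚ p) +ₚ p) k          ≡⟨ coeff-+ₚ (-ₚ p) p k ⟩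
  coeff (-ₚ p) k ℤ.+ coeff p k   ≡⟨ cong (ℤ._+ coeff p k) (coeff-negₚ p k) ⟩
  ℤ.- coeff p k ℤ.+ coeff p k    ≡⟨ ℤP.+-inverseˡ (coeff p k) ⟩
  + 0                            ∎
  where open ≡-Reasoning

+ₚ-interchange : ∀ w x y z → (w +ₚ x) +ₚ (y +ₚ z) ≡ (w +ₚ y) +ₚ (x +ₚ z)
+ₚ-interchange w x y z = begin
  (w +ₚ x) +ₚ (y +ₚ z)   ≡⟨ +ₚ-assoc w x (y +ₚ z) ⟩
  w +ₚ (x +ₚ (y +ₚ z))   ≡⟨ cong (w +ₚ_) (+ₚ-assoc x y z) ⟨
  w +ₚ ((x +ₚ y) +ₚ z)   ≡⟨ cong (λ t → w +ₚ (t +ₚ z)) (+ₚ-comm x y) ⟩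
  w +ₚ ((y +ₚ x) +ₚ z)   ≡⟨ cong (w +ₚ_) (+ₚ-assoc y x z) ⟩
  w +ₚ (y +ₚ (x +ₚ z))   ≡⟨ +ₚ-assoc w y (x +ₚ z) ⟨
  (w +ₚ y) +ₚ (x +ₚ z)   ∎
  where open ≡-Reasoning

+ₚ-leftComm : ∀ x y z → x +ₚ (y +ₚ z) ≡ y +ₚ (x +ₚ z)
+ₚ-leftComm x y z = begin
  x +ₚ (y +ₚ z)   ≡⟨ +ₚ-assoc x y z ⟨
  (x +ₚ y) +ₚ z   ≡⟨ cong (_+ₚ z) (+ₚ-comm x y) ⟩
  (y +ₚ x) +ₚ z   ≡⟨ +ₚ-assoc y x z ⟩
  y +ₚ (x +ₚ z)   ∎
  where open ≡-Reasoning

+ₚ-cong : ∀ {p p′ q q′} → p ≈ p′ → q ≈ q′ → p +ₚ q ≈ p′ +ₚ q′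
+ₚ-cong {p} {p′} {q} {q′} p≈p′ q≈q′ = coeffwise λ k → begin
  coeff (p +ₚ q) k           ≡⟨ coeff-+ₚ p q k ⟩
  coeff p k ℤ.+ coeff q k    ≡⟨ cong₂ ℤ._+_ (coeff-≡ p≈p′ k) (coeff-≡ q≈q′ k) ⟩
  coeff p′ k ℤ.+ coeff q′ k  ≡⟨ coeff-+ₚ p′ q′ k ⟨
  coeff (p′ +ₚ q′) k         ∎
  where open ≡-Reasoning

+ₚ-congˡ : ∀ p {q q′} → q ≈ q′ → p +ₚ q ≈ p +ₚ q′
+ₚ-congˡ p = +ₚ-cong ≈-refl

+ₚ-congʳ : ∀ q {p p′} → p ≈ p′ → p +ₚ q ≈ p′ +ₚ q
+ₚ-congʳ q p≈p′ = +ₚ-cong p≈p′ ≈-refl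

-ₚ-cong : ∀ {p q} → p ≈ q → -ₚ p ≈ -ₚ q
-ₚ-cong {p} {q} p≈q = coeffwise λ k →
  trans (coeff-negₚ p k) (trans (cong ℤ.-_ (coeff-≡ p≈q k)) (sym (coeff-negₚ q k)))

-ₚ-distrib-+ₚ : ∀ p q → -ₚ (p +ₚ q) ≈ (-ₚ p) +ₚ (-ₚ q)
-ₚ-distrib-+ₚ p q = coeffwise λ k → begin
  coeff (-ₚ (p +ₚ q)) k                    ≡⟨ coeff-negₚ (p +ₚ q) k ⟩
  ℤ.- coeff (p +ₚ q) k                     ≡⟨ cong ℤ.-_ (coeff-+ₚ p q k) ⟩
  ℤ.- (coeff p k ℤ.+ coeff q k)            ≡⟨ ℤP.neg-distrib-+ (coeff p k) (coeff q k) ⟩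
  ℤ.- coeff p k ℤ.+ ℤ.- coeff q k          ≡⟨ cong₂ ℤ._+_ (coeff-negₚ p k) (coeff-negₚ q k) ⟨
  coeff (-ₚ p) k ℤ.+ coeff (-ₚ q) k        ≡⟨ coeff-+ₚ (-ₚ p) (-ₚ q) k ⟨
  coeff ((-ₚ p) +ₚ (-ₚ q)) k               ∎
  where open ≡-Reasoning

·ₚ-congˡ : ∀ a {p q} → p ≈ q → a ·ₚ p ≈ a ·ₚ q
·ₚ-congˡ a {p} {q} p≈q = coeffwise λ k →
  trans (coeff-·ₚ a p k) (trans (cong (a ℤ.*_) (coeff-≡ p≈q k)) (sym (coeff-·ₚ a q k)))

·ₚ-distrib-+ₚ : ∀ a p q → a ·ₚ (p +ₚ q) ≈ a ·ₚ p +ₚ a ·ₚ q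
·ₚ-distrib-+ₚ a p q = coeffwise λ k → begin
  coeff (a ·ₚ (p +ₚ q)) k                    ≡⟨ coeff-·ₚ a (p +ₚ q) k ⟩
  a ℤ.* coeff (p +ₚ q) k                     ≡⟨ cong (a ℤ.*_) (coeff-+ₚ p q k) ⟩
  a ℤ.* (coeff p k ℤ.+ coeff q k)            ≡⟨ ℤP.*-distribˡ-+ a (coeff p k) (coeff q k) ⟩
  a ℤ.* coeff p k ℤ.+ a ℤ.* coeff q k        ≡⟨ cong₂ ℤ._+_ (coeff-·ₚ a p k) (coeff-·ₚ a q k) ⟨
  coeff (a ·ₚ p) k ℤ.+ coeff (a ·ₚ q) k      ≡⟨ coeff-+ₚ (a ·ₚ p) (a ·ₚ q) k ⟨
  coeff (a ·ₚ p +ₚ a ·ₚ q) k                 ∎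
  where open ≡-Reasoning

+-distrib-·ₚ : ∀ a b p → (a ℤ.+ b) ·ₚ p ≈ a ·ₚ p +ₚ b ·ₚ p
+-distrib-·ₚ a b p = coeffwise λ k → begin
  coeff ((a ℤ.+ b) ·ₚ p) k                   ≡⟨ coeff-·ₚ (a ℤ.+ b) p k ⟩
  (a ℤ.+ b) ℤ.* coeff p k                    ≡⟨ ℤP.*-distribʳ-+ (coeff p k) a b ⟩
  a ℤ.* coeff p k ℤ.+ b ℤ.* coeff p k        ≡⟨ cong₂ ℤ._+_ (coeff-·ₚ a p k) (coeff-·ₚ b p k) ⟨
  coeff (a ·ₚ p) k ℤ.+ coeff (b ·ₚ p) k      ≡⟨ coeff-+ₚ (a ·ₚ p) (b ·ₚ p) k ⟨
  coeff (a ·ₚ p +ₚ b ·ₚ p) k                 ∎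
  where open ≡-Reasoning

·ₚ-assoc : ∀ a b p → a ·ₚ (b ·ₚ p) ≈ (a ℤ.* b) ·ₚ p
·ₚ-assoc a b p = coeffwise λ k → begin
  coeff (a ·ₚ (b ·ₚ p)) k   ≡⟨ coeff-·ₚ a (b ·ₚ p) k ⟩
  a ℤ.* coeff (b ·ₚ p) k    ≡⟨ cong (a ℤ.*_) (coeff-·ₚ b p k) ⟩
  a ℤ.* (b ℤ.* coeff p k)   ≡⟨ ℤP.*-assoc a b (coeff p k) ⟨
  a ℤ.* b ℤ.* coeff p k     ≡⟨ coeff-·ₚ (a ℤ.* b) p k ⟨
  coeff ((a ℤ.* b) ·ₚ p) k  ∎
  where open ≡-Reasoning

·ₚ-identityˡ : ∀ p → (+ 1) ·ₚ p ≈ p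
·ₚ-identityˡ p = coeffwise λ k → trans (coeff-·ₚ (+ 1) p k) (ℤP.*-identityˡ _)

·ₚ-zeroˡ : ∀ p → (+ 0) ·ₚ p ≈ 0ₚ
·ₚ-zeroˡ p = coeffwise λ k → trans (coeff-·ₚ (+ 0) p k) (ℤP.*-zeroˡ (coeff p k))

*ₚ-zeroʳ : ∀ p → p *ₚ 0ₚ ≈ 0ₚ
*ₚ-zeroʳ []      = ≈-refl
*ₚ-zeroʳ (a ∷ p) = coeffwise λ { zero → refl ; (suc k) → coeff-≡ (*ₚ-zeroʳ p) k }

*ₚ-absorbˡ : ∀ p q → p ≈ 0ₚ → p *ₚ q ≈ 0ₚ
*ₚ-absorbˡ []      q p≈0 = ≈-refl
*ₚ-absorbˡ (a ∷ p) q p≈0 = begin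
  a ·ₚ q +ₚ (+ 0 ∷ p *ₚ q)  ≈⟨ +ₚ-cong a·q≈0 (∷-congʳ (+ 0) (*ₚ-absorbˡ p q (coeffwise λ k → coeff-≡ p≈0 (suc k)))) ⟩
  0ₚ +ₚ (+ 0 ∷ 0ₚ)          ≈⟨ coeffwise (λ { zero → refl ; (suc k) → refl }) ⟩
  0ₚ                        ∎
  where
  open ≈-Reasoning
  a·q≈0 : a ·ₚ q ≈ 0ₚ
  a·q≈0 = ≈-trans (≈-reflexive (cong (_·ₚ q) (coeff-≡ p≈0 zero))) (·ₚ-zeroˡ q)

*ₚ-congʳ : ∀ q {p p′} → p ≈ p′ → p *ₚ q ≈ p′ *ₚ q
*ₚ-congʳ q {[]}    {[]}     p≈p′ = ≈-refl
*ₚ-congʳ q {[]}    {a ∷ p′} p≈p′ = ≈-sym (*ₚ-absorbˡ (a ∷ p′) q (≈-sym p≈p′))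
*ₚ-congʳ q {a ∷ p} {[]}     p≈p′ = *ₚ-absorbˡ (a ∷ p) q p≈p′
*ₚ-congʳ q {a ∷ p} {b ∷ p′} p≈p′ =
  +ₚ-cong (≈-reflexive (cong (_·ₚ q) (∷-injectiveˡ p≈p′)))
          (∷-congʳ (+ 0) (*ₚ-congʳ q (∷-injectiveʳ p≈p′)))

*ₚ-congˡ : ∀ p {q q′} → q ≈ q′ → p *ₚ q ≈ p *ₚ q′
*ₚ-congˡ []      q≈q′ = ≈-refl
*ₚ-congˡ (a ∷ p) q≈q′ = +ₚ-cong (·ₚ-congˡ a q≈q′) (∷-congʳ (+ 0) (*ₚ-congˡ p q≈q′))

*ₚ-cong : ∀ {p p′ q q′} → p ≈ p′ → q ≈ q′ → p *ₚ q ≈ p′ *ₚ q′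
*ₚ-cong {p} {p′} {q} p≈p′ q≈q′ = ≈-trans (*ₚ-congʳ q p≈p′) (*ₚ-congˡ p′ q≈q′)

·ₚ-*ₚ : ∀ a p q → (a ·ₚ p) *ₚ q ≈ a ·ₚ (p *ₚ q)
·ₚ-*ₚ a []      q = ≈-refl
·ₚ-*ₚ a (b ∷ p) q = begin
  (a ℤ.* b) ·ₚ q +ₚ (+ 0 ∷ (a ·ₚ p) *ₚ q)     ≈⟨ +ₚ-cong (≈-sym (·ₚ-assoc a b q)) (∷-cong (sym (ℤP.*-zeroʳ a)) (·ₚ-*ₚ a p q)) ⟩
  a ·ₚ (b ·ₚ q) +ₚ a ·ₚ (+ 0 ∷ p *ₚ q)        ≈⟨ ·ₚ-distrib-+ₚ a (b ·ₚ q) (+ 0 ∷ p *ₚ q) ⟨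
  a ·ₚ (b ·ₚ q +ₚ (+ 0 ∷ p *ₚ q))             ∎
  where open ≈-Reasoning

*ₚ-shiftˡ : ∀ p q → (+ 0 ∷ p) *ₚ q ≈ + 0 ∷ p *ₚ q
*ₚ-shiftˡ p q = +ₚ-congʳ (+ 0 ∷ p *ₚ q) (·ₚ-zeroˡ q)

*ₚ-distribʳ : ∀ s p q → (p +ₚ q) *ₚ s ≈ (p *ₚ s) +ₚ (q *ₚ s)
*ₚ-distribʳ s []      q       = ≈-refl
*ₚ-distribʳ s (a ∷ p) []      = ≈-reflexive (sym (+ₚ-identityʳ _))
*ₚ-distribʳ s (a ∷ p) (b ∷ q) = begin
  (a ℤ.+ b) ·ₚ s +ₚ (+ 0 ∷ (p +ₚ q) *ₚ s)
    ≈⟨ +ₚ-cong (+-distrib-·ₚ a b s) (∷-congʳ (+ 0) (*ₚ-distribʳ s p q)) ⟩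
  (a ·ₚ s +ₚ b ·ₚ s) +ₚ ((+ 0 ∷ p *ₚ s) +ₚ (+ 0 ∷ q *ₚ s))
    ≈⟨ ≈-reflexive (+ₚ-interchange (a ·ₚ s) (b ·ₚ s) (+ 0 ∷ p *ₚ s) (+ 0 ∷ q *ₚ s)) ⟩
  (a ·ₚ s +ₚ (+ 0 ∷ p *ₚ s)) +ₚ (b ·ₚ s +ₚ (+ 0 ∷ q *ₚ s)) ∎
  where open ≈-Reasoning

*ₚ-consʳ : ∀ b p q → p *ₚ (b ∷ q) ≈ b ·ₚ p +ₚ (+ 0 ∷ p *ₚ q)
*ₚ-consʳ b []      q = coeffwise λ { zero → refl ; (suc k) → refl }
*ₚ-consʳ b (a ∷ p) q = ∷-cong (cong (ℤ._+ + 0) (ℤP.*-comm a b)) (begin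
  a ·ₚ q +ₚ (p *ₚ (b ∷ q))                  ≈⟨ +ₚ-congˡ (a ·ₚ q) (*ₚ-consʳ b p q) ⟩
  a ·ₚ q +ₚ (b ·ₚ p +ₚ (+ 0 ∷ p *ₚ q))     ≡⟨ +ₚ-leftComm (a ·ₚ q) (b ·ₚ p) (+ 0 ∷ p *ₚ q) ⟩
  b ·ₚ p +ₚ (a ·ₚ q +ₚ (+ 0 ∷ p *ₚ q))     ∎)
  where open ≈-Reasoning

*ₚ-comm : ∀ p q → p *ₚ q ≈ q *ₚ p
*ₚ-comm []      q       = ≈-sym (*ₚ-zeroʳ q)
*ₚ-comm (a ∷ p) []      = *ₚ-zeroʳ (a ∷ p)
*ₚ-comm (a ∷ p) (b ∷ q) = ∷-cong (cong (ℤ._+ + 0) (ℤP.*-comm a b)) (begin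
  a ·ₚ q +ₚ (p *ₚ (b ∷ q))                  ≈⟨ +ₚ-congˡ (a ·ₚ q) (*ₚ-consʳ b p q) ⟩
  a ·ₚ q +ₚ (b ·ₚ p +ₚ (+ 0 ∷ p *ₚ q))     ≡⟨ +ₚ-leftComm (a ·ₚ q) (b ·ₚ p) (+ 0 ∷ p *ₚ q) ⟩
  b ·ₚ p +ₚ (a ·ₚ q +ₚ (+ 0 ∷ p *ₚ q))     ≈⟨ +ₚ-congˡ (b ·ₚ p) (+ₚ-congˡ (a ·ₚ q) (∷-congʳ (+ 0) (*ₚ-comm p q))) ⟩
  b ·ₚ p +ₚ (a ·ₚ q +ₚ (+ 0 ∷ q *ₚ p))     ≈⟨ +ₚ-congˡ (b ·ₚ p) (*ₚ-consʳ a q p) ⟨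
  b ·ₚ p +ₚ (q *ₚ (a ∷ p))                  ∎)
  where open ≈-Reasoning

*ₚ-absorbʳ : ∀ p q → q ≈ 0ₚ → p *ₚ q ≈ 0ₚ
*ₚ-absorbʳ p q q≈0 = ≈-trans (*ₚ-comm p q) (*ₚ-absorbˡ q p q≈0)

*ₚ-assoc : ∀ p q s → (p *ₚ q) *ₚ s ≈ p *ₚ (q *ₚ s)
*ₚ-assoc []      q s = ≈-refl
*ₚ-assoc (a ∷ p) q s = begin
  (a ·ₚ q +ₚ (+ 0 ∷ p *ₚ q)) *ₚ s                 ≈⟨ *ₚ-distribʳ s (a ·ₚ q) (+ 0 ∷ p *ₚ q) ⟩
  ((a ·ₚ q) *ₚ s) +ₚ ((+ 0 ∷ p *ₚ q) *ₚ s)        ≈⟨ +ₚ-cong (·ₚ-*ₚ a q s) (*ₚ-shiftˡ (p *ₚ q) s) ⟩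
  a ·ₚ (q *ₚ s) +ₚ (+ 0 ∷ (p *ₚ q) *ₚ s)          ≈⟨ +ₚ-congˡ (a ·ₚ (q *ₚ s)) (∷-congʳ (+ 0) (*ₚ-assoc p q s)) ⟩
  a ·ₚ (q *ₚ s) +ₚ (+ 0 ∷ p *ₚ (q *ₚ s))          ∎
  where open ≈-Reasoning

*ₚ-identityˡ : ∀ p → 1ₚ *ₚ p ≈ p
*ₚ-identityˡ p = begin
  (+ 1) ·ₚ p +ₚ (+ 0 ∷ [])   ≈⟨ +ₚ-cong (·ₚ-identityˡ p) (coeffwise λ { zero → refl ; (suc k) → refl }) ⟩
  p +ₚ []                    ≡⟨ +ₚ-identityʳ p ⟩
  p                          ∎
  where open ≈-Reasoning

*ₚ-identityʳ : ∀ p → p *ₚ 1ₚ ≈ p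
*ₚ-identityʳ p = ≈-trans (*ₚ-comm p 1ₚ) (*ₚ-identityˡ p)

1ₚ^ₚ≈1ₚ : ∀ k → 1ₚ ^ₚ k ≈ 1ₚ
1ₚ^ₚ≈1ₚ zero    = ≈-refl
1ₚ^ₚ≈1ₚ (suc k) = ≈-trans (*ₚ-identityˡ (1ₚ ^ₚ k)) (1ₚ^ₚ≈1ₚ k)

*ₚ-distribˡ : ∀ s p q → s *ₚ (p +ₚ q) ≈ (s *ₚ p) +ₚ (s *ₚ q)
*ₚ-distribˡ s p q = begin
  s *ₚ (p +ₚ q)             ≈⟨ *ₚ-comm s (p +ₚ q) ⟩
  (p +ₚ q) *ₚ s             ≈⟨ *ₚ-distribʳ s p q ⟩
  (p *ₚ s) +ₚ (q *ₚ s)      ≈⟨ +ₚ-cong (*ₚ-comm p s) (*ₚ-comm q s) ⟩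
  (s *ₚ p) +ₚ (s *ₚ q)      ∎
  where open ≈-Reasoning

-ₚ‿inverseʳ : ∀ p → p +ₚ (-ₚ p) ≈ 0ₚ
-ₚ‿inverseʳ p = ≈-trans (≈-reflexive (+ₚ-comm p (-ₚ p))) (-ₚ‿inverseˡ p)

Poly-commutativeRing : CommutativeRing 0ℓ 0ℓ
Poly-commutativeRing = record
  { Carrier = Poly ; _≈_ = _≈_ ; _+_ = _+ₚ_ ; _*_ = _*ₚ_ ; -_ = -ₚ_ ; 0# = 0ₚ ; 1# = 1ₚ
  ; isCommutativeRing = record
    { isRing = record
      { +-isAbelianGroup = record
        { isGroup = record
          { isMonoid = record
            { isSemigroup = record
              { isMagma = record { isEquivalence = Setoid.isEquivalence ≈-setoid ; ∙-cong = +ₚ-cong }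
              ; assoc = λ p q s → ≈-reflexive (+ₚ-assoc p q s) }
            ; identity = (λ _ → ≈-refl) , (λ p → ≈-reflexive (+ₚ-identityʳ p)) }
          ; inverse = -ₚ‿inverseˡ , -ₚ‿inverseʳ
          ; ⁻¹-cong = -ₚ-cong }
        ; comm = λ p q → ≈-reflexive (+ₚ-comm p q) }
      ; *-cong = *ₚ-cong
      ; *-assoc = *ₚ-assoc
      ; *-identity = *ₚ-identityˡ , *ₚ-identityʳ
      ; distrib = *ₚ-distribˡ , *ₚ-distribʳ }
    ; *-comm = *ₚ-comm } }

Poly-almostCommutativeRing : ACR.AlmostCommutativeRing 0ℓ 0ℓ
Poly-almostCommutativeRing = ACR.fromCommutativeRing Poly-commutativeRing (λ _ → nothing)

-ₚ-*ₚˡ : ∀ p q → (-ₚ p) *ₚ q ≈ -ₚ (p *ₚ q)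
-ₚ-*ₚˡ = PolySolver.solve-∀ Poly-almostCommutativeRing

*ₚ-leftComm : ∀ p q s → p *ₚ (q *ₚ s) ≈ q *ₚ (p *ₚ s)
*ₚ-leftComm = PolySolver.solve-∀ Poly-almostCommutativeRing

X*ₚ : ∀ p → X *ₚ p ≈ + 0 ∷ p
X*ₚ p = begin
  (+ 0) ·ₚ p +ₚ (+ 0 ∷ (1ₚ *ₚ p))   ≈⟨ +ₚ-cong (·ₚ-zeroˡ p) (∷-congʳ (+ 0) (*ₚ-identityˡ p)) ⟩
  0ₚ +ₚ (+ 0 ∷ p)                   ∎
  where open ≈-Reasoning

monomial≈ : ∀ z k → monomial z k ≈ (z ∷ []) *ₚ (X ^ₚ k)
monomial≈ z zero    = ≈-sym (*ₚ-identityʳ (z ∷ []))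
monomial≈ z (suc k) = begin
  + 0 ∷ monomial z k                  ≈⟨ ∷-congʳ (+ 0) (monomial≈ z k) ⟩
  + 0 ∷ ((z ∷ []) *ₚ (X ^ₚ k))        ≈⟨ X*ₚ ((z ∷ []) *ₚ (X ^ₚ k)) ⟨
  X *ₚ ((z ∷ []) *ₚ (X ^ₚ k))         ≈⟨ *ₚ-leftComm X (z ∷ []) (X ^ₚ k) ⟩
  (z ∷ []) *ₚ (X *ₚ (X ^ₚ k))         ∎
  where open ≈-Reasoning

open import Algebra.Properties.Group (CommutativeRing.+-group Poly-commutativeRing) using (inverseʳ-unique)

when : Bool → Poly → Poly
when true  p = p
when false p = 0ₚ

∑ : ∀ {A : Set} → List A → (A → Poly) → Poly
∑ xs f = sumₚ (map f xs)

when-cong : ∀ b {p q} → p ≈ q → when b p ≈ when b q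
when-cong true  p≈q = p≈q
when-cong false p≈q = ≈-refl

when-zero : ∀ b {p} → p ≈ 0ₚ → when b p ≈ 0ₚ
when-zero true  p≈0 = p≈0
when-zero false p≈0 = ≈-refl

when-∧ : ∀ b c p → when (b ∧ c) p ≡ when b (when c p)
when-∧ true  c p = refl
when-∧ false c p = refl

when-comm : ∀ b c p → when b (when c p) ≡ when c (when b p)
when-comm true  c     p = refl
when-comm false true  p = refl
when-comm false false p = refl

when-+ₚ : ∀ b p q → when b (p +ₚ q) ≈ when b p +ₚ when b q
when-+ₚ true  p q = ≈-refl
when-+ₚ false p q = ≈-refl

when-*ₚʳ : ∀ b p q → q *ₚ when b p ≈ when b (q *ₚ p)
when-*ₚʳ true  p q = ≈-refl
when-*ₚʳ false p q = *ₚ-zeroʳ q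

when-dec-cong : ∀ {P : Set} (P? : Dec P) {p q} → (P → p ≈ q) → when (does P?) p ≈ when (does P?) q
when-dec-cong (yes P) p≈q = p≈q P
when-dec-cong (no ¬P) p≈q = ≈-refl

∑-cong : ∀ {A : Set} (xs : List A) {f g : A → Poly} → (∀ x → f x ≈ g x) → ∑ xs f ≈ ∑ xs g
∑-cong []       f≈g = ≈-refl
∑-cong (x ∷ xs) f≈g = +ₚ-cong (f≈g x) (∑-cong xs f≈g)

∑-zero : ∀ {A : Set} (xs : List A) {f : A → Poly} → (∀ x → f x ≈ 0ₚ) → ∑ xs f ≈ 0ₚ
∑-zero []       f≈0 = ≈-refl
∑-zero (x ∷ xs) f≈0 = +ₚ-cong (f≈0 x) (∑-zero xs f≈0)

∑-++ : ∀ {A : Set} (xs ys : List A) (f : A → Poly) → ∑ (xs ++ ys) f ≈ ∑ xs f +ₚ ∑ ys f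
∑-++ []       ys f = ≈-refl
∑-++ (x ∷ xs) ys f = ≈-trans (+ₚ-congˡ (f x) (∑-++ xs ys f)) (≈-reflexive (sym (+ₚ-assoc (f x) _ _)))

∑-map : ∀ {A B : Set} (g : A → B) (xs : List A) (f : B → Poly) → ∑ (map g xs) f ≈ ∑ xs (f ∘ g)
∑-map g []       f = ≈-refl
∑-map g (x ∷ xs) f = +ₚ-congˡ (f (g x)) (∑-map g xs f)

∑-concatMap : ∀ {A B : Set} (g : A → List B) (xs : List A) (f : B → Poly) →
              ∑ (concatMap g xs) f ≈ ∑ xs (λ x → ∑ (g x) f)
∑-concatMap g []       f = ≈-refl
∑-concatMap g (x ∷ xs) f = ≈-trans (∑-++ (g x) (concatMap g xs) f) (+ₚ-congˡ (∑ (g x) f) (∑-concatMap g xs f))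

∑-filter : ∀ {A : Set} {P : A → Set} (P? : Decidable P) (xs : List A) (f : A → Poly) →
           ∑ (filter P? xs) f ≈ ∑ xs (λ x → when (does (P? x)) (f x))
∑-filter P? []       f = ≈-refl
∑-filter P? (x ∷ xs) f with does (P? x)
... | true  = +ₚ-congˡ (f x) (∑-filter P? xs f)
... | false = ∑-filter P? xs f

∑-+ₚ : ∀ {A : Set} (xs : List A) (f g : A → Poly) → ∑ xs (λ x → f x +ₚ g x) ≈ ∑ xs f +ₚ ∑ xs g
∑-+ₚ []       f g = ≈-refl
∑-+ₚ (x ∷ xs) f g = ≈-trans (+ₚ-congˡ (f x +ₚ g x) (∑-+ₚ xs f g)) (≈-reflexive (+ₚ-interchange (f x) (g x) _ _))

∑-*ₚˡ : ∀ {A : Set} (xs : List A) (s : Poly) (f : A → Poly) → ∑ xs (λ x → s *ₚ f x) ≈ s *ₚ ∑ xs f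
∑-*ₚˡ []       s f = ≈-sym (*ₚ-zeroʳ s)
∑-*ₚˡ (x ∷ xs) s f = ≈-trans (+ₚ-congˡ (s *ₚ f x) (∑-*ₚˡ xs s f)) (≈-sym (*ₚ-distribˡ s (f x) _))

∑-when : ∀ {A : Set} (xs : List A) (b : Bool) (f : A → Poly) → ∑ xs (λ x → when b (f x)) ≈ when b (∑ xs f)
∑-when xs true  f = ≈-refl
∑-when xs false f = ∑-zero xs (λ _ → ≈-refl)

∑-swap : ∀ {A B : Set} (xs : List A) (ys : List B) (f : A → B → Poly) →
         ∑ xs (λ x → ∑ ys (f x)) ≈ ∑ ys (λ y → ∑ xs (λ x → f x y))
∑-swap []       ys f = ≈-sym (∑-zero ys (λ _ → ≈-refl))
∑-swap (x ∷ xs) ys f = ≈-trans (+ₚ-congˡ (∑ ys (f x)) (∑-swap xs ys f))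
                               (≈-sym (∑-+ₚ ys (f x) (λ y → ∑ xs (λ x′ → f x′ y))))

sumℤ-∑ : ∀ {A : Set} (xs : List A) (g : A → ℤ) → sumℤ (map g xs) ∷ [] ≈ ∑ xs (λ x → g x ∷ [])
sumℤ-∑ []       g = coeffwise λ { zero → refl ; (suc k) → refl }
sumℤ-∑ (x ∷ xs) g = +ₚ-congˡ (g x ∷ []) (sumℤ-∑ xs g)

∑-upTo-suc : ∀ n (f : ℕ → Poly) → ∑ (upTo (suc n)) f ≈ f 0 +ₚ ∑ (upTo n) (f ∘ suc)
∑-upTo-suc n f = +ₚ-congˡ (f 0) (begin
  ∑ (applyUpTo suc n) f        ≡⟨ cong (λ xs → ∑ xs f) (map-applyUpTo id suc n) ⟨
  ∑ (map suc (upTo n)) f       ≈⟨ ∑-map suc (upTo n) f ⟩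
  ∑ (upTo n) (f ∘ suc)         ∎)
  where open ≈-Reasoning

∑-upTo-zero : ∀ n (f : ℕ → Poly) → (∀ i → i < n → f i ≈ 0ₚ) → ∑ (upTo n) f ≈ 0ₚ
∑-upTo-zero zero    f f≈0 = ≈-refl
∑-upTo-zero (suc n) f f≈0 = ≈-trans (∑-upTo-suc n f)
  (+ₚ-cong (f≈0 0 (s≤s z≤n)) (∑-upTo-zero n (f ∘ suc) (λ i i<n → f≈0 (suc i) (s≤s i<n))))

∑-upTo-single : ∀ n (f : ℕ → Poly) i → i < n → (∀ j → j < n → j ≢ i → f j ≈ 0ₚ) → ∑ (upTo n) f ≈ f i
∑-upTo-single (suc n) f zero    i<n f≈0 = ≈-trans (∑-upTo-suc n f) (≈-trans
  (+ₚ-congˡ (f 0) (∑-upTo-zero n (f ∘ suc) (λ j j<n → f≈0 (suc j) (s≤s j<n) λ ()))) (≈-reflexive (+ₚ-identityʳ (f 0))))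
∑-upTo-single (suc n) f (suc i) (s≤s i<n) f≈0 = ≈-trans (∑-upTo-suc n f)
  (+ₚ-cong (f≈0 0 (s≤s z≤n) λ ()) (∑-upTo-single n (f ∘ suc) i i<n (λ j j<n j≢i → f≈0 (suc j) (s≤s j<n) (j≢i ∘ ℕP.suc-injective))))

X-1 : Poly
X-1 = X +ₚ (-ₚ 1ₚ)

coeff-X-1*ₚ-zero : ∀ s → coeff (X-1 *ₚ s) 0 ≡ ℤ.- coeff s 0
coeff-X-1*ₚ-zero s = begin
  coeff (X-1 *ₚ s) 0                       ≡⟨ coeff-+ₚ (ℤ.-1ℤ ·ₚ s) _ 0 ⟩
  coeff (ℤ.-1ℤ ·ₚ s) 0 ℤ.+ + 0             ≡⟨ ℤP.+-identityʳ _ ⟩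
  coeff (ℤ.-1ℤ ·ₚ s) 0                     ≡⟨ coeff-·ₚ ℤ.-1ℤ s 0 ⟩
  ℤ.-1ℤ ℤ.* coeff s 0                      ≡⟨ ℤP.-1*i≡-i (coeff s 0) ⟩
  ℤ.- coeff s 0                            ∎
  where open ≡-Reasoning

coeff-X-1*ₚ-suc : ∀ s k → coeff (X-1 *ₚ s) (suc k) ≡ coeff s k ℤ.- coeff s (suc k)
coeff-X-1*ₚ-suc s k = begin
  coeff (X-1 *ₚ s) (suc k)                                     ≡⟨ coeff-+ₚ (ℤ.-1ℤ ·ₚ s) _ (suc k) ⟩
  coeff (ℤ.-1ℤ ·ₚ s) (suc k) ℤ.+ coeff (1ₚ *ₚ s) k             ≡⟨ cong₂ ℤ._+_ (coeff-·ₚ ℤ.-1ℤ s (suc k)) (coeff-≡ (*ₚ-identityˡ s) k) ⟩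
  ℤ.-1ℤ ℤ.* coeff s (suc k) ℤ.+ coeff s k                      ≡⟨ cong (ℤ._+ coeff s k) (ℤP.-1*i≡-i (coeff s (suc k))) ⟩
  ℤ.- coeff s (suc k) ℤ.+ coeff s k                            ≡⟨ ℤP.+-comm (ℤ.- coeff s (suc k)) (coeff s k) ⟩
  coeff s k ℤ.- coeff s (suc k)                                ∎
  where open ≡-Reasoning

coeff-beyond-length : ∀ s k → length s ≤ k → coeff s k ≡ + 0
coeff-beyond-length []      k       _         = refl
coeff-beyond-length (a ∷ s) (suc k) (s≤s s≤k) = coeff-beyond-length s k s≤k

-- The coefficients of s are then all equal, and almost all of them vanish.
X-1*ₚ-constant⇒zero : ∀ s → (∀ k → coeff (X-1 *ₚ s) (suc k) ≡ + 0) → s ≈ 0ₚ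
X-1*ₚ-constant⇒zero s tail≡0 = coeffwise λ k →
  trans (coeff-shift (length s) k) (coeff-beyond-length s (length s ℕ.+ k) (ℕP.m≤m+n (length s) k))
  where
  coeff-shift : ∀ j k → coeff s k ≡ coeff s (j ℕ.+ k)
  coeff-shift zero    k = refl
  coeff-shift (suc j) k = trans (coeff-shift j k)
    (ℤP.i-j≡0⇒i≡j _ _ (trans (sym (coeff-X-1*ₚ-suc s (j ℕ.+ k))) (tail≡0 (j ℕ.+ k))))

divByQ-1-∷∷ : ∀ a b as → divByQ-1 (a ∷ b ∷ as) ≡ ℤ.- a ∷ divByQ-1 (a ℤ.+ b ∷ as)
divByQ-1-∷∷ a b []       rewrite ℤP.+-identityˡ a = refl
divByQ-1-∷∷ a b (c ∷ as) rewrite ℤP.+-identityˡ a | ℤP.+-identityˡ (a ℤ.+ b) = refl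

divByQ-1-correct-∷ : ∀ a as s → a ∷ as ≈ X-1 *ₚ s → divByQ-1 (a ∷ as) ≈ s
divByQ-1-correct-∷ a []       s p≈ = ≈-sym (X-1*ₚ-constant⇒zero s (λ k → sym (coeff-≡ p≈ (suc k))))
divByQ-1-correct-∷ a (b ∷ as) s p≈ rewrite divByQ-1-∷∷ a b as = coeffwise λ
  { zero    → head
  ; (suc k) → trans (coeff-≡ (divByQ-1-correct-∷ (a ℤ.+ b) as (tail s) tail≈) k) (coeff-tail s k) }
  where
  tail : Poly → Poly
  tail []      = []
  tail (x ∷ s) = s
  coeff-tail : ∀ s k → coeff (tail s) k ≡ coeff s (suc k)
  coeff-tail []      k = refl
  coeff-tail (x ∷ s) k = refl
  a≡ : a ≡ ℤ.- coeff s 0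
  a≡ = trans (coeff-≡ p≈ 0) (coeff-X-1*ₚ-zero s)
  head : ℤ.- a ≡ coeff s 0
  head = trans (cong ℤ.-_ a≡) (ℤP.neg-involutive _)
  tail≈ : a ℤ.+ b ∷ as ≈ X-1 *ₚ tail s
  tail≈ = coeffwise λ
    { zero → begin
        a ℤ.+ b                                           ≡⟨ cong₂ ℤ._+_ a≡ (trans (coeff-≡ p≈ 1) (coeff-X-1*ₚ-suc s 0)) ⟩
        ℤ.- coeff s 0 ℤ.+ (coeff s 0 ℤ.- coeff s 1)       ≡⟨ telescope (coeff s 0) (coeff s 1) ⟩
        ℤ.- coeff s 1                                     ≡⟨ cong ℤ.-_ (coeff-tail s 0) ⟨
        ℤ.- coeff (tail s) 0                              ≡⟨ coeff-X-1*ₚ-zero (tail s) ⟨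
        coeff (X-1 *ₚ tail s) 0                           ∎
    ; (suc k) → begin
        coeff as k                                        ≡⟨ coeff-≡ p≈ (suc (suc k)) ⟩
        coeff (X-1 *ₚ s) (suc (suc k))                    ≡⟨ coeff-X-1*ₚ-suc s (suc k) ⟩
        coeff s (suc k) ℤ.- coeff s (suc (suc k))         ≡⟨ cong₂ ℤ._-_ (coeff-tail s k) (coeff-tail s (suc k)) ⟨
        coeff (tail s) k ℤ.- coeff (tail s) (suc k)       ≡⟨ coeff-X-1*ₚ-suc (tail s) k ⟨
        coeff (X-1 *ₚ tail s) (suc k)                     ∎ }
    where
    open ≡-Reasoning
    telescope : ∀ x y → ℤ.- x ℤ.+ (x ℤ.- y) ≡ ℤ.- y
    telescope = solve-∀

divByQ-1-correct : ∀ p s → p ≈ X-1 *ₚ s → divByQ-1 p ≈ s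
divByQ-1-correct []       s p≈ = ≈-sym (X-1*ₚ-constant⇒zero s (λ k → sym (coeff-≡ p≈ (suc k))))
divByQ-1-correct (a ∷ as) s p≈ = divByQ-1-correct-∷ a as s p≈

descents : List ℕ → List ℕ
descents = descentsFrom 1

descentsFrom-descent : ∀ i {x y} ys → y < x → descentsFrom i (x ∷ y ∷ ys) ≡ i ∷ descentsFrom (suc i) (y ∷ ys)
descentsFrom-descent i {x} {y} ys y<x with y <? x
... | yes _   = refl
... | no  y≮x = contradiction y<x y≮x

descentsFrom-ascent : ∀ i {x y} ys → ¬ y < x → descentsFrom i (x ∷ y ∷ ys) ≡ descentsFrom (suc i) (y ∷ ys)
descentsFrom-ascent i {x} {y} ys y≮x with y <? x
... | yes y<x = contradiction y<x y≮x
... | no  _   = refl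

descentsFrom-suc : ∀ i ℓ → descentsFrom (suc i) ℓ ≡ map suc (descentsFrom i ℓ)
descentsFrom-suc i []           = refl
descentsFrom-suc i (x ∷ [])     = refl
descentsFrom-suc i (x ∷ y ∷ ys) = by-cases (y <? x) (descentsFrom-suc (suc i) (y ∷ ys))
  where
  open ≡-Reasoning
  by-cases : Dec (y < x) → descentsFrom (suc (suc i)) (y ∷ ys) ≡ map suc (descentsFrom (suc i) (y ∷ ys)) →
             descentsFrom (suc i) (x ∷ y ∷ ys) ≡ map suc (descentsFrom i (x ∷ y ∷ ys))
  by-cases (yes y<x) IH = begin
    descentsFrom (suc i) (x ∷ y ∷ ys)              ≡⟨ descentsFrom-descent (suc i) ys y<x ⟩
    suc i ∷ descentsFrom (suc (suc i)) (y ∷ ys)    ≡⟨ cong (suc i ∷_) IH ⟩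
    map suc (i ∷ descentsFrom (suc i) (y ∷ ys))    ≡⟨ cong (map suc) (descentsFrom-descent i ys y<x) ⟨
    map suc (descentsFrom i (x ∷ y ∷ ys))          ∎
  by-cases (no y≮x) IH = begin
    descentsFrom (suc i) (x ∷ y ∷ ys)              ≡⟨ descentsFrom-ascent (suc i) ys y≮x ⟩
    descentsFrom (suc (suc i)) (y ∷ ys)            ≡⟨ IH ⟩
    map suc (descentsFrom (suc i) (y ∷ ys))        ≡⟨ cong (map suc) (descentsFrom-ascent i ys y≮x) ⟨
    map suc (descentsFrom i (x ∷ y ∷ ys))          ∎

descents-descent : ∀ {x y} r → y < x → descents (x ∷ y ∷ r) ≡ 1 ∷ map suc (descents (y ∷ r))
descents-descent r y<x = trans (descentsFrom-descent 1 r y<x) (cong (1 ∷_) (descentsFrom-suc 1 (_ ∷ r)))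

descents-ascent : ∀ {x y} r → ¬ y < x → descents (x ∷ y ∷ r) ≡ map suc (descents (y ∷ r))
descents-ascent r y≮x = trans (descentsFrom-ascent 1 r y≮x) (descentsFrom-suc 1 (_ ∷ r))

0∉descents : ∀ ℓ → 0 ∉ₗ descents ℓ
0∉descents ℓ 0∈ with ∈-map⁻ suc (subst (0 ∈ₗ_) (descentsFrom-suc 0 ℓ) 0∈)
... | _ , _ , ()

Isolated : List ℕ → Set
Isolated D = All (λ i → suc i ∉ₗ D) D

isolated? : ∀ D → Dec (Isolated D)
isolated? D = All.all? (λ i → suc i ∉ₗ? D) D

suc∈map-suc⁻ : ∀ {i} D → suc i ∈ₗ map suc D → i ∈ₗ D
suc∈map-suc⁻ D suc-i∈ with ∈-map⁻ suc suc-i∈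
... | j , j∈D , refl = j∈D

isolated-map-suc : ∀ D → Isolated (map suc D) ⇔ Isolated D
isolated-map-suc D = mk⇔
  (λ iso → All.map (λ suc-i∉ suc-i∈ → suc-i∉ (∈-map⁺ suc suc-i∈)) (All.map⁻ iso))
  (λ iso → All.map⁺ (All.map (λ suc-i∉ suc-i∈ → suc-i∉ (suc∈map-suc⁻ D suc-i∈)) iso))

goodDes-map-suc : ∀ D → 0 ∉ₗ D → GoodDes (map suc D) ⇔ Isolated D
goodDes-map-suc D 0∉D = mk⇔
  (λ (iso , _) → Equivalence.to (isolated-map-suc D) iso)
  (λ iso → Equivalence.from (isolated-map-suc D) iso , 0∉D ∘ suc∈map-suc⁻ D)

isolated-1∷map-suc : ∀ D → Isolated (1 ∷ map suc D) ⇔ GoodDes D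
isolated-1∷map-suc D = mk⇔
  (λ { (2∉ ∷ iso) → All.map (λ suc-i∉ suc-i∈ → suc-i∉ (there (∈-map⁺ suc suc-i∈))) (All.map⁻ iso)
                  , 2∉ ∘ there ∘ ∈-map⁺ suc })
  (λ (iso , 1∉D) → (λ { (here ()) ; (there 2∈) → 1∉D (suc∈map-suc⁻ D 2∈) })
                 ∷ All.map⁺ (All.map (λ suc-i∉ → λ { (here ()) ; (there suc-i∈) → suc-i∉ (suc∈map-suc⁻ D suc-i∈) }) iso))

¬goodDes-1∷ : ∀ D → ¬ GoodDes (1 ∷ D)
¬goodDes-1∷ D (_ , 1∉) = 1∉ (here refl)

length-descents-descent : ∀ {x y} r → y < x → length (descents (x ∷ y ∷ r)) ≡ suc (length (descents (y ∷ r)))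
length-descents-descent {x} {y} r y<x = trans (cong length (descents-descent r y<x)) (cong suc (length-map suc (descents (y ∷ r))))

length-descents-ascent : ∀ {x y} r → ¬ y < x → length (descents (x ∷ y ∷ r)) ≡ length (descents (y ∷ r))
length-descents-ascent {x} {y} r y≮x = trans (cong length (descents-ascent r y≮x)) (length-map suc (descents (y ∷ r)))

isolated⇒2*des≤length : ∀ ℓ → Isolated (descents ℓ) → 2 ℕ.* length (descents ℓ) ≤ length ℓ
goodDes⇒2*des<length : ∀ ℓ → ℓ ≢ [] → GoodDes (descents ℓ) → 2 ℕ.* length (descents ℓ) < length ℓ

isolated⇒2*des≤length []          _   = z≤n
isolated⇒2*des≤length (x ∷ [])    _   = z≤n
isolated⇒2*des≤length (x ∷ y ∷ r) iso =
  by-cases (y <? x) (isolated⇒2*des≤length (y ∷ r)) (goodDes⇒2*des<length (y ∷ r) λ ())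
  where
  open ℕP.≤-Reasoning
  D = descents (y ∷ r)
  by-cases : Dec (y < x) → (Isolated D → 2 ℕ.* length D ≤ length (y ∷ r)) →
             (GoodDes D → 2 ℕ.* length D < length (y ∷ r)) →
             2 ℕ.* length (descents (x ∷ y ∷ r)) ≤ length (x ∷ y ∷ r)
  by-cases (yes y<x) _ good-bound = begin
    2 ℕ.* length (descents (x ∷ y ∷ r))   ≡⟨ cong (2 ℕ.*_) (length-descents-descent r y<x) ⟩
    2 ℕ.* suc (length D)                  ≡⟨ ℕP.*-suc 2 (length D) ⟩
    suc (suc (2 ℕ.* length D))            ≤⟨ s≤s (good-bound (Equivalence.to (isolated-1∷map-suc D) (subst Isolated (descents-descent r y<x) iso))) ⟩
    length (x ∷ y ∷ r)                    ∎
  by-cases (no y≮x) iso-bound _ = begin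
    2 ℕ.* length (descents (x ∷ y ∷ r))   ≡⟨ cong (2 ℕ.*_) (length-descents-ascent r y≮x) ⟩
    2 ℕ.* length D                        ≤⟨ iso-bound (Equivalence.to (isolated-map-suc D) (subst Isolated (descents-ascent r y≮x) iso)) ⟩
    length (y ∷ r)                        ≤⟨ ℕP.n≤1+n _ ⟩
    length (x ∷ y ∷ r)                    ∎

goodDes⇒2*des<length []          []≢[] _    = contradiction refl []≢[]
goodDes⇒2*des<length (x ∷ [])    _     _    = s≤s z≤n
goodDes⇒2*des<length (x ∷ y ∷ r) _     good = by-cases (y <? x) (isolated⇒2*des≤length (y ∷ r))
  where
  open ℕP.≤-Reasoning
  D = descents (y ∷ r)
  by-cases : Dec (y < x) → (Isolated D → 2 ℕ.* length D ≤ length (y ∷ r)) →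
             2 ℕ.* length (descents (x ∷ y ∷ r)) < length (x ∷ y ∷ r)
  by-cases (yes y<x) _ = contradiction (subst GoodDes (descents-descent r y<x) good) (¬goodDes-1∷ _)
  by-cases (no y≮x) iso-bound = begin-strict
    2 ℕ.* length (descents (x ∷ y ∷ r))   ≡⟨ cong (2 ℕ.*_) (length-descents-ascent r y≮x) ⟩
    2 ℕ.* length D                        ≤⟨ iso-bound (Equivalence.to (isolated-map-suc D) (proj₁ (subst GoodDes (descents-ascent r y≮x) good))) ⟩
    length (y ∷ r)                        <⟨ ℕP.n<1+n _ ⟩
    length (x ∷ y ∷ r)                    ∎

guardedMonomial : Bool → ℕ → ℕ → Poly
guardedMonomial b d e = when b ((X ^ₚ d) *ₚ (X+1 ^ₚ e))

guardedMonomial-cong : ∀ {b b′ d d′ e e′} → b ≡ b′ → d ≡ d′ → e ≡ e′ →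
                       guardedMonomial b d e ≡ guardedMonomial b′ d′ e′
guardedMonomial-cong refl refl refl = refl

guardedMonomial-false : ∀ {b} d e → b ≡ false → guardedMonomial b d e ≈ 0ₚ
guardedMonomial-false d e refl = ≈-refl

guardedMonomial-sucˡ : ∀ b d e → guardedMonomial b (suc d) e ≈ X *ₚ guardedMonomial b d e
guardedMonomial-sucˡ true  d e = *ₚ-assoc X (X ^ₚ d) (X+1 ^ₚ e)
guardedMonomial-sucˡ false d e = ≈-sym (*ₚ-zeroʳ X)

guardedMonomial-sucʳ : ∀ b d e → guardedMonomial b d (suc e) ≈ X+1 *ₚ guardedMonomial b d e
guardedMonomial-sucʳ true  d e = *ₚ-leftComm (X ^ₚ d) X+1 (X+1 ^ₚ e)
guardedMonomial-sucʳ false d e = ≈-sym (*ₚ-zeroʳ X+1)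

descentWeight : List ℕ → Poly
descentWeight ℓ = guardedMonomial (does (goodDes? (descents ℓ)))
                    (length (descents ℓ)) (length ℓ ∸ 1 ∸ 2 ℕ.* length (descents ℓ))

descentWeight⁺ : List ℕ → Poly
descentWeight⁺ ℓ = guardedMonomial (does (isolated? (descents ℓ)))
                     (length (descents ℓ)) (length ℓ ∸ 2 ℕ.* length (descents ℓ))

descentWeight-descent : ∀ {x y} r → y < x → descentWeight (x ∷ y ∷ r) ≈ 0ₚ
descentWeight-descent {x} {y} r y<x = guardedMonomial-false (length E) (length (x ∷ y ∷ r) ∸ 1 ∸ 2 ℕ.* length E)
  (dec-false (goodDes? E) (¬goodDes-1∷ _ ∘ subst GoodDes (descents-descent r y<x)))
  where E = descents (x ∷ y ∷ r)

descentWeight-ascent : ∀ {x y} r → ¬ y < x → descentWeight (x ∷ y ∷ r) ≈ descentWeight⁺ (y ∷ r)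
descentWeight-ascent {x} {y} r y≮x = ≈-reflexive (guardedMonomial-cong
  (does-⇔ good⇔iso (goodDes? (descents (x ∷ y ∷ r))) (isolated? D))
  (length-descents-ascent r y≮x)
  (cong (λ d → length (y ∷ r) ∸ 2 ℕ.* d) (length-descents-ascent r y≮x)))
  where
  D = descents (y ∷ r)
  good⇔iso : GoodDes (descents (x ∷ y ∷ r)) ⇔ Isolated D
  good⇔iso = subst (λ E → GoodDes E ⇔ Isolated D) (sym (descents-ascent r y≮x)) (goodDes-map-suc D (0∉descents (y ∷ r)))

descentWeight⁺-descent : ∀ {x y} r → y < x → descentWeight⁺ (x ∷ y ∷ r) ≈ X *ₚ descentWeight (y ∷ r)
descentWeight⁺-descent {x} {y} r y<x = ≈-trans
  (≈-reflexive (guardedMonomial-cong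
    (does-⇔ iso⇔good (isolated? (descents (x ∷ y ∷ r))) (goodDes? D))
    (length-descents-descent r y<x)
    (trans (cong (λ d → length (x ∷ y ∷ r) ∸ 2 ℕ.* d) (length-descents-descent r y<x))
           (cong (length (x ∷ y ∷ r) ∸_) (ℕP.*-suc 2 (length D))))))
  (guardedMonomial-sucˡ (does (goodDes? D)) (length D) (length (y ∷ r) ∸ 1 ∸ 2 ℕ.* length D))
  where
  D = descents (y ∷ r)
  iso⇔good : Isolated (descents (x ∷ y ∷ r)) ⇔ GoodDes D
  iso⇔good = subst (λ E → Isolated E ⇔ GoodDes D) (sym (descents-descent r y<x)) (isolated-1∷map-suc D)

descentWeight⁺-ascent : ∀ {x y} r → ¬ y < x → descentWeight⁺ (x ∷ y ∷ r) ≈ X+1 *ₚ descentWeight⁺ (y ∷ r)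
descentWeight⁺-ascent {x} {y} r y≮x = ≈-trans
  (≈-reflexive (guardedMonomial-cong
    (does-⇔ iso⇔iso (isolated? (descents (x ∷ y ∷ r))) (isolated? D))
    (length-descents-ascent r y≮x)
    (cong (λ d → length (x ∷ y ∷ r) ∸ 2 ℕ.* d) (length-descents-ascent r y≮x))))
  (by-cases (isolated? D))
  where
  D = descents (y ∷ r)
  iso⇔iso : Isolated (descents (x ∷ y ∷ r)) ⇔ Isolated D
  iso⇔iso = subst (λ E → Isolated E ⇔ Isolated D) (sym (descents-ascent r y≮x)) (isolated-map-suc D)
  by-cases : (iso? : Dec (Isolated D)) →
             guardedMonomial (does iso?) (length D) (length (x ∷ y ∷ r) ∸ 2 ℕ.* length D) ≈
             X+1 *ₚ guardedMonomial (does iso?) (length D) (length (y ∷ r) ∸ 2 ℕ.* length D)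
  -- 2 des ≤ length (y ∷ r) is what makes the truncated subtraction commute with suc.
  by-cases (yes iso) = ≈-trans
    (≈-reflexive (cong (guardedMonomial true (length D)) (ℕP.+-∸-assoc 1 (isolated⇒2*des≤length (y ∷ r) iso))))
    (guardedMonomial-sucʳ true (length D) (length (y ∷ r) ∸ 2 ℕ.* length D))
  by-cases (no _) = ≈-sym (*ₚ-zeroʳ X+1)

increasing : List ℕ → Bool
increasing ℓ = does (linked? _≤?_ ℓ)

strictlyDecreasing : List ℕ → Bool
strictlyDecreasing ℓ = does (linked? _>?_ ℓ)

negOnePow : ℕ → ℤ
negOnePow zero    = + 1
negOnePow (suc n) = ℤ.- negOnePow n

möbiusWeight : List ℕ → Poly
möbiusWeight u = when (strictlyDecreasing u) (negOnePow (length u) ∷ [])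

increasingWeight : Poly → List ℕ → Poly
increasingWeight Q v = when (increasing v) (Q ^ₚ length v)

-- The contribution of a maximal chain with labels λ₁ ⋯ λₖ to the reduced characteristic
-- polynomial: (-1)ʲ Qᵏ⁻¹⁻ʲ if λ₁ > ⋯ > λⱼ₊₁ ≤ ⋯ ≤ λₖ, and 0 otherwise.
redCharWeight : Poly → List ℕ → Poly
redCharWeight Q []          = 0ₚ
redCharWeight Q (x ∷ [])    = 1ₚ
redCharWeight Q (x ∷ y ∷ r) = if does (y <? x) then -ₚ redCharWeight Q (y ∷ r) else increasingWeight Q (y ∷ r)

redCharWeight-descent : ∀ Q {x y} r → y < x → redCharWeight Q (x ∷ y ∷ r) ≡ -ₚ redCharWeight Q (y ∷ r)
redCharWeight-descent Q {x} {y} r y<x rewrite dec-true (y <? x) y<x = refl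

redCharWeight-ascent : ∀ Q {x y} r → ¬ y < x → redCharWeight Q (x ∷ y ∷ r) ≡ increasingWeight Q (y ∷ r)
redCharWeight-ascent Q {x} {y} r y≮x rewrite dec-false (y <? x) y≮x = refl

increasingWeight-descent : ∀ Q {x y} r → y < x → increasingWeight Q (x ∷ y ∷ r) ≡ 0ₚ
increasingWeight-descent Q {x} {y} r y<x rewrite dec-false (x ≤? y) (ℕP.<⇒≱ y<x) = refl

increasing-ascent : ∀ {x y} r → ¬ y < x → increasing (x ∷ y ∷ r) ≡ increasing (y ∷ r)
increasing-ascent {x} {y} r y≮x rewrite dec-true (x ≤? y) (ℕP.≮⇒≥ y≮x) = refl

increasingWeight-ascent : ∀ Q {x y} r → ¬ y < x → increasingWeight Q (x ∷ y ∷ r) ≈ Q *ₚ increasingWeight Q (y ∷ r)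
increasingWeight-ascent Q {x} {y} r y≮x = ≈-trans
  (≈-reflexive (cong (λ b → when b (Q ^ₚ length (x ∷ y ∷ r))) (increasing-ascent r y≮x)))
  (≈-sym (when-*ₚʳ (increasing (y ∷ r)) (Q ^ₚ length (y ∷ r)) Q))

möbiusWeight-descent : ∀ {x y} u → y < x → möbiusWeight (x ∷ y ∷ u) ≡ -ₚ möbiusWeight (y ∷ u)
möbiusWeight-descent {x} {y} u y<x rewrite dec-true (x >? y) y<x with strictlyDecreasing (y ∷ u)
... | true  = refl
... | false = refl

möbiusWeight-ascent : ∀ {x y} u → ¬ y < x → möbiusWeight (x ∷ y ∷ u) ≡ 0ₚ
möbiusWeight-ascent {x} {y} u y≮x rewrite dec-false (x >? y) y≮x = refl

splitSum : ∀ {A : Set} → (List A → List A → Poly) → List A → Poly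
splitSum F []      = F [] []
splitSum F (x ∷ ℓ) = F [] (x ∷ ℓ) +ₚ splitSum (λ u v → F (x ∷ u) v) ℓ

splitSum-cong : ∀ {A : Set} {F G : List A → List A → Poly} ℓ → (∀ u v → F u v ≈ G u v) → splitSum F ℓ ≈ splitSum G ℓ
splitSum-cong []      F≈G = F≈G [] []
splitSum-cong (x ∷ ℓ) F≈G = +ₚ-cong (F≈G [] (x ∷ ℓ)) (splitSum-cong ℓ (λ u → F≈G (x ∷ u)))

splitSum-zero : ∀ {A : Set} {F : List A → List A → Poly} ℓ → (∀ u v → F u v ≈ 0ₚ) → splitSum F ℓ ≈ 0ₚ
splitSum-zero []      F≈0 = F≈0 [] []
splitSum-zero (x ∷ ℓ) F≈0 = +ₚ-cong (F≈0 [] (x ∷ ℓ)) (splitSum-zero ℓ (λ u → F≈0 (x ∷ u)))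

splitSum-*ₚˡ : ∀ {A : Set} s (F : List A → List A → Poly) ℓ → splitSum (λ u v → s *ₚ F u v) ℓ ≈ s *ₚ splitSum F ℓ
splitSum-*ₚˡ s F []      = ≈-refl
splitSum-*ₚˡ s F (x ∷ ℓ) = ≈-trans (+ₚ-congˡ (s *ₚ F [] (x ∷ ℓ)) (splitSum-*ₚˡ s _ ℓ)) (≈-sym (*ₚ-distribˡ s _ _))

splitSum-negₚ : ∀ {A : Set} (F : List A → List A → Poly) ℓ → splitSum (λ u v → -ₚ F u v) ℓ ≈ -ₚ splitSum F ℓ
splitSum-negₚ F []      = ≈-refl
splitSum-negₚ F (x ∷ ℓ) = ≈-trans (+ₚ-congˡ (-ₚ F [] (x ∷ ℓ)) (splitSum-negₚ _ ℓ)) (≈-sym (-ₚ-distrib-+ₚ (F [] (x ∷ ℓ)) _))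

möbius⊗increasing : Poly → List ℕ → List ℕ → Poly
möbius⊗increasing Q u v = möbiusWeight u *ₚ increasingWeight Q v

splitSum-möbius⊗increasing-descent : ∀ Q {x y} r → y < x →
  splitSum (möbius⊗increasing Q) (x ∷ y ∷ r) ≈ -ₚ splitSum (möbius⊗increasing Q) (y ∷ r)
splitSum-möbius⊗increasing-descent Q {x} {y} r y<x = begin
  F [] (x ∷ y ∷ r) +ₚ (F (x ∷ []) (y ∷ r) +ₚ splitSum (λ u → F (x ∷ y ∷ u)) r)
    ≈⟨ +ₚ-cong (≈-trans (*ₚ-congˡ 1ₚ (≈-reflexive (increasingWeight-descent Q r y<x))) (*ₚ-zeroʳ 1ₚ))
               (+ₚ-cong (-ₚ-*ₚˡ 1ₚ (increasingWeight Q (y ∷ r)))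
                        (splitSum-cong r λ u v → ≈-trans (*ₚ-congʳ (increasingWeight Q v) (≈-reflexive (möbiusWeight-descent u y<x)))
                                                         (-ₚ-*ₚˡ (möbiusWeight (y ∷ u)) (increasingWeight Q v)))) ⟩
  0ₚ +ₚ splitSum (λ u v → -ₚ F u v) (y ∷ r)
    ≈⟨ splitSum-negₚ F (y ∷ r) ⟩
  -ₚ splitSum F (y ∷ r) ∎
  where
  open ≈-Reasoning
  F = möbius⊗increasing Q

splitSum-möbius⊗increasing-ascent : ∀ Q {x y} r → ¬ y < x →
  splitSum (möbius⊗increasing Q) (x ∷ y ∷ r) ≈ (Q +ₚ (-ₚ 1ₚ)) *ₚ increasingWeight Q (y ∷ r)
splitSum-möbius⊗increasing-ascent Q {x} {y} r y≮x = begin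
  F [] (x ∷ y ∷ r) +ₚ (F (x ∷ []) (y ∷ r) +ₚ splitSum (λ u → F (x ∷ y ∷ u)) r)
    ≈⟨ +ₚ-cong (≈-trans (≈-reflexive (cong (λ c → 1ₚ *ₚ when c (Q *ₚ Qⁿ)) (increasing-ascent r y≮x))) (when-*ₚʳ b (Q *ₚ Qⁿ) 1ₚ))
               (+ₚ-cong (when-*ₚʳ b Qⁿ (-ₚ 1ₚ))
                        (splitSum-zero r λ u v → *ₚ-absorbˡ _ (increasingWeight Q v) (≈-reflexive (möbiusWeight-ascent u y≮x)))) ⟩
  when b (1ₚ *ₚ (Q *ₚ Qⁿ)) +ₚ (when b ((-ₚ 1ₚ) *ₚ Qⁿ) +ₚ 0ₚ)
    ≡⟨ cong (when b (1ₚ *ₚ (Q *ₚ Qⁿ)) +ₚ_) (+ₚ-identityʳ _) ⟩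
  when b (1ₚ *ₚ (Q *ₚ Qⁿ)) +ₚ when b ((-ₚ 1ₚ) *ₚ Qⁿ)
    ≈⟨ when-+ₚ b _ _ ⟨
  when b ((1ₚ *ₚ (Q *ₚ Qⁿ)) +ₚ ((-ₚ 1ₚ) *ₚ Qⁿ))
    ≈⟨ when-cong b (identity Q Qⁿ) ⟩
  when b ((Q +ₚ (-ₚ 1ₚ)) *ₚ Qⁿ)
    ≈⟨ when-*ₚʳ b Qⁿ (Q +ₚ (-ₚ 1ₚ)) ⟨
  (Q +ₚ (-ₚ 1ₚ)) *ₚ increasingWeight Q (y ∷ r) ∎
  where
  open ≈-Reasoning
  F = möbius⊗increasing Q
  b = increasing (y ∷ r)
  Qⁿ = Q ^ₚ length (y ∷ r)
  identity : ∀ Q p → (1ₚ *ₚ (Q *ₚ p)) +ₚ ((-ₚ 1ₚ) *ₚ p) ≈ (Q +ₚ (-ₚ 1ₚ)) *ₚ p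
  identity = PolySolver.solve-∀ Poly-almostCommutativeRing

-- Splitting a maximal chain at c turns Σ μ(a,c) Q^(rk b - rk c) into this sum, so this is
-- where χ(Q) = (Q - 1) χ̄(Q) is seen chain by chain.
splitSum-möbius⊗increasing : ∀ Q ℓ → ℓ ≢ [] →
  splitSum (möbius⊗increasing Q) ℓ ≈ (Q +ₚ (-ₚ 1ₚ)) *ₚ redCharWeight Q ℓ
splitSum-möbius⊗increasing Q []          []≢[] = contradiction refl []≢[]
splitSum-möbius⊗increasing Q (x ∷ [])    _     = identity Q
  where
  identity : ∀ Q → (1ₚ *ₚ (Q *ₚ 1ₚ)) +ₚ ((-ₚ 1ₚ) *ₚ 1ₚ) ≈ (Q +ₚ (-ₚ 1ₚ)) *ₚ 1ₚ
  identity = PolySolver.solve-∀ Poly-almostCommutativeRing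
splitSum-möbius⊗increasing Q (x ∷ y ∷ r) _ =
  by-cases (y <? x) (splitSum-möbius⊗increasing Q (y ∷ r) λ ())
  where
  by-cases : Dec (y < x) → splitSum (möbius⊗increasing Q) (y ∷ r) ≈ (Q +ₚ (-ₚ 1ₚ)) *ₚ redCharWeight Q (y ∷ r) →
             splitSum (möbius⊗increasing Q) (x ∷ y ∷ r) ≈ (Q +ₚ (-ₚ 1ₚ)) *ₚ redCharWeight Q (x ∷ y ∷ r)
  by-cases (yes y<x) IH = begin
    splitSum (möbius⊗increasing Q) (x ∷ y ∷ r)         ≈⟨ splitSum-möbius⊗increasing-descent Q r y<x ⟩
    -ₚ splitSum (möbius⊗increasing Q) (y ∷ r)          ≈⟨ -ₚ-cong IH ⟩
    -ₚ ((Q +ₚ (-ₚ 1ₚ)) *ₚ redCharWeight Q (y ∷ r))      ≈⟨ neg-*ₚʳ (Q +ₚ (-ₚ 1ₚ)) (redCharWeight Q (y ∷ r)) ⟩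
    (Q +ₚ (-ₚ 1ₚ)) *ₚ (-ₚ redCharWeight Q (y ∷ r))      ≡⟨ cong ((Q +ₚ (-ₚ 1ₚ)) *ₚ_) (redCharWeight-descent Q r y<x) ⟨
    (Q +ₚ (-ₚ 1ₚ)) *ₚ redCharWeight Q (x ∷ y ∷ r)       ∎
    where
    open ≈-Reasoning
    neg-*ₚʳ : ∀ p q → -ₚ (p *ₚ q) ≈ p *ₚ (-ₚ q)
    neg-*ₚʳ = PolySolver.solve-∀ Poly-almostCommutativeRing
  by-cases (no y≮x) _ = ≈-trans (splitSum-möbius⊗increasing-ascent Q r y≮x)
    (≈-reflexive (cong ((Q +ₚ (-ₚ 1ₚ)) *ₚ_) (sym (redCharWeight-ascent Q r y≮x))))

splitSum-möbius⊗increasing-at-1 : ∀ ℓ → ℓ ≢ [] → splitSum (möbius⊗increasing 1ₚ) ℓ ≈ 0ₚ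
splitSum-möbius⊗increasing-at-1 ℓ ℓ≢[] = ≈-trans (splitSum-möbius⊗increasing 1ₚ ℓ ℓ≢[])
  (*ₚ-absorbˡ (1ₚ +ₚ (-ₚ 1ₚ)) (redCharWeight 1ₚ ℓ) (coeffwise λ { zero → refl ; (suc k) → refl }))

increasingPrefixSum : ℕ → List ℕ → Poly
increasingPrefixSum y = splitSum λ u v → increasingWeight X (y ∷ u) *ₚ descentWeight v

increasingPrefixSum-descent : ∀ {y z} r → z < y → increasingPrefixSum y (z ∷ r) ≈ X *ₚ descentWeight (z ∷ r)
increasingPrefixSum-descent {y} {z} r z<y = begin
  ((X *ₚ 1ₚ) *ₚ descentWeight (z ∷ r)) +ₚ splitSum (λ u v → increasingWeight X (y ∷ z ∷ u) *ₚ descentWeight v) r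
    ≈⟨ +ₚ-cong (*ₚ-congʳ (descentWeight (z ∷ r)) (*ₚ-identityʳ X))
               (splitSum-zero r λ u v → ≈-reflexive (cong (_*ₚ descentWeight v) (increasingWeight-descent X u z<y))) ⟩
  (X *ₚ descentWeight (z ∷ r)) +ₚ 0ₚ
    ≡⟨ +ₚ-identityʳ _ ⟩
  X *ₚ descentWeight (z ∷ r) ∎
  where open ≈-Reasoning

increasingPrefixSum-ascent : ∀ {y z} r → ¬ z < y →
  increasingPrefixSum y (z ∷ r) ≈ X *ₚ (increasingPrefixSum z r +ₚ descentWeight (z ∷ r))
increasingPrefixSum-ascent {y} {z} r z≮y = begin
  ((X *ₚ 1ₚ) *ₚ descentWeight (z ∷ r)) +ₚ splitSum (λ u v → increasingWeight X (y ∷ z ∷ u) *ₚ descentWeight v) r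
    ≈⟨ +ₚ-cong (*ₚ-congʳ (descentWeight (z ∷ r)) (*ₚ-identityʳ X))
               (splitSum-cong r λ u v → ≈-trans (*ₚ-congʳ (descentWeight v) (increasingWeight-ascent X u z≮y))
                                                (*ₚ-assoc X (increasingWeight X (z ∷ u)) (descentWeight v))) ⟩
  (X *ₚ descentWeight (z ∷ r)) +ₚ splitSum (λ u v → X *ₚ (increasingWeight X (z ∷ u) *ₚ descentWeight v)) r
    ≈⟨ +ₚ-congˡ (X *ₚ descentWeight (z ∷ r)) (splitSum-*ₚˡ X _ r) ⟩
  (X *ₚ descentWeight (z ∷ r)) +ₚ (X *ₚ increasingPrefixSum z r)
    ≈⟨ identity X (descentWeight (z ∷ r)) (increasingPrefixSum z r) ⟩
  X *ₚ (increasingPrefixSum z r +ₚ descentWeight (z ∷ r)) ∎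
  where
  open ≈-Reasoning
  identity : ∀ x p a → (x *ₚ p) +ₚ (x *ₚ a) ≈ x *ₚ (a +ₚ p)
  identity = PolySolver.solve-∀ Poly-almostCommutativeRing

descentWeight⁺-split : ∀ y r → increasingPrefixSum y r +ₚ descentWeight (y ∷ r) ≈ descentWeight⁺ (y ∷ r)
descentWeight⁺-split y []      = coeffwise λ { zero → refl ; (suc zero) → refl ; (suc (suc k)) → refl }
descentWeight⁺-split y (z ∷ r) = by-cases (z <? y) (descentWeight⁺-split z r)
  where
  by-cases : Dec (z < y) → increasingPrefixSum z r +ₚ descentWeight (z ∷ r) ≈ descentWeight⁺ (z ∷ r) →
             increasingPrefixSum y (z ∷ r) +ₚ descentWeight (y ∷ z ∷ r) ≈ descentWeight⁺ (y ∷ z ∷ r)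
  by-cases (yes z<y) _ = begin
    increasingPrefixSum y (z ∷ r) +ₚ descentWeight (y ∷ z ∷ r)
      ≈⟨ +ₚ-cong (increasingPrefixSum-descent r z<y) (descentWeight-descent r z<y) ⟩
    (X *ₚ descentWeight (z ∷ r)) +ₚ 0ₚ
      ≡⟨ +ₚ-identityʳ _ ⟩
    X *ₚ descentWeight (z ∷ r)
      ≈⟨ descentWeight⁺-descent r z<y ⟨
    descentWeight⁺ (y ∷ z ∷ r) ∎
    where open ≈-Reasoning
  by-cases (no z≮y) IH = begin
    increasingPrefixSum y (z ∷ r) +ₚ descentWeight (y ∷ z ∷ r)
      ≈⟨ +ₚ-cong (increasingPrefixSum-ascent r z≮y) (descentWeight-ascent r z≮y) ⟩
    (X *ₚ (increasingPrefixSum z r +ₚ descentWeight (z ∷ r))) +ₚ descentWeight⁺ (z ∷ r)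
      ≈⟨ +ₚ-congʳ (descentWeight⁺ (z ∷ r)) (*ₚ-congˡ X IH) ⟩
    (X *ₚ descentWeight⁺ (z ∷ r)) +ₚ descentWeight⁺ (z ∷ r)
      ≈⟨ distrib X (descentWeight⁺ (z ∷ r)) ⟩
    X+1 *ₚ descentWeight⁺ (z ∷ r)
      ≈⟨ descentWeight⁺-ascent r z≮y ⟨
    descentWeight⁺ (y ∷ z ∷ r) ∎
    where
    open ≈-Reasoning
    distrib : ∀ x p → (x *ₚ p) +ₚ p ≈ (x +ₚ 1ₚ) *ₚ p
    distrib = PolySolver.solve-∀ Poly-almostCommutativeRing

redChar⊗descent : List ℕ → List ℕ → Poly
redChar⊗descent u v = redCharWeight X u *ₚ descentWeight v

splitSum-redChar⊗descent-descent : ∀ {x y} r → y < x →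
  splitSum redChar⊗descent (x ∷ y ∷ r) ≈ descentWeight (y ∷ r) +ₚ (-ₚ splitSum redChar⊗descent (y ∷ r))
splitSum-redChar⊗descent-descent {x} {y} r y<x = +ₚ-cong (*ₚ-identityˡ (descentWeight (y ∷ r))) (begin
  splitSum (λ u → redChar⊗descent (x ∷ y ∷ u)) r
    ≈⟨ splitSum-cong r (λ u v → ≈-trans (≈-reflexive (cong (_*ₚ descentWeight v) (redCharWeight-descent X u y<x)))
                                        (-ₚ-*ₚˡ (redCharWeight X (y ∷ u)) (descentWeight v))) ⟩
  splitSum (λ u v → -ₚ redChar⊗descent (y ∷ u) v) r
    ≈⟨ splitSum-negₚ (λ u → redChar⊗descent (y ∷ u)) r ⟩
  -ₚ splitSum redChar⊗descent (y ∷ r) ∎)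
  where open ≈-Reasoning

splitSum-redChar⊗descent-ascent : ∀ {x y} r → ¬ y < x →
  splitSum redChar⊗descent (x ∷ y ∷ r) ≈ descentWeight (y ∷ r) +ₚ increasingPrefixSum y r
splitSum-redChar⊗descent-ascent {x} {y} r y≮x = +ₚ-cong (*ₚ-identityˡ (descentWeight (y ∷ r)))
  (splitSum-cong r λ u v → ≈-reflexive (cong (_*ₚ descentWeight v) (redCharWeight-ascent X u y≮x)))

-- Splitting a maximal chain at every flat of a flag chain turns the Chow polynomial into
-- this sum, so this identity is the theorem for a single chain.
splitSum-redChar⊗descent : ∀ ℓ → ℓ ≢ [] → splitSum redChar⊗descent ℓ ≈ descentWeight ℓ
splitSum-redChar⊗descent []          []≢[] = contradiction refl []≢[]
splitSum-redChar⊗descent (x ∷ [])    _     = coeffwise λ { zero → refl ; (suc k) → refl }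
splitSum-redChar⊗descent (x ∷ y ∷ r) _     = by-cases (y <? x) (splitSum-redChar⊗descent (y ∷ r) λ ())
  where
  by-cases : Dec (y < x) → splitSum redChar⊗descent (y ∷ r) ≈ descentWeight (y ∷ r) →
             splitSum redChar⊗descent (x ∷ y ∷ r) ≈ descentWeight (x ∷ y ∷ r)
  by-cases (yes y<x) IH = begin
    splitSum redChar⊗descent (x ∷ y ∷ r)                       ≈⟨ splitSum-redChar⊗descent-descent r y<x ⟩
    descentWeight (y ∷ r) +ₚ (-ₚ splitSum redChar⊗descent (y ∷ r))  ≈⟨ +ₚ-congˡ (descentWeight (y ∷ r)) (-ₚ-cong IH) ⟩
    descentWeight (y ∷ r) +ₚ (-ₚ descentWeight (y ∷ r))        ≈⟨ -ₚ‿inverseʳ (descentWeight (y ∷ r)) ⟩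
    0ₚ                                                         ≈⟨ descentWeight-descent r y<x ⟨
    descentWeight (x ∷ y ∷ r)                                  ∎
    where open ≈-Reasoning
  by-cases (no y≮x) _ = begin
    splitSum redChar⊗descent (x ∷ y ∷ r)                 ≈⟨ splitSum-redChar⊗descent-ascent r y≮x ⟩
    descentWeight (y ∷ r) +ₚ increasingPrefixSum y r     ≡⟨ +ₚ-comm (descentWeight (y ∷ r)) _ ⟩
    increasingPrefixSum y r +ₚ descentWeight (y ∷ r)     ≈⟨ descentWeight⁺-split y r ⟩
    descentWeight⁺ (y ∷ r)                               ≈⟨ descentWeight-ascent r y≮x ⟨
    descentWeight (x ∷ y ∷ r)                            ∎
    where open ≈-Reasoning

∪-least : ∀ {m} {A B C : Subset m} → A ⊆ C → B ⊆ C → A ∪ B ⊆ C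
∪-least {A = A} {B} A⊆C B⊆C x∈A∪B with x∈p∪q⁻ A B x∈A∪B
... | inj₁ x∈A = A⊆C x∈A
... | inj₂ x∈B = B⊆C x∈B

⁅⁆⊆ : ∀ {m} {x} {B : Subset m} → x ∈ B → ⁅ x ⁆ ⊆ B
⁅⁆⊆ {B = B} x∈B y∈⁅x⁆ = subst (_∈ B) (sym (x∈⁅y⁆⇒x≡y _ y∈⁅x⁆)) x∈B

⊆∧≢⇒⊂ : ∀ {m} {c b : Subset m} → c ⊆ b → c ≢ b → c ⊂ b
⊆∧≢⇒⊂ {c = c} {b} c⊆b c≢b with any? (λ x → (x ∈? b) ×-dec ¬? (x ∈? c))
... | yes (x , x∈b , x∉c) = c⊆b , x , x∈b , x∉c
... | no ∄x = contradiction (⊆-antisym c⊆b b⊆c) c≢b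
  where
  b⊆c : b ⊆ c
  b⊆c {x} x∈b with x ∈? c
  ... | yes x∈c = x∈c
  ... | no  x∉c = contradiction (x , x∈b , x∉c) ∄x

≢⇒⊆⇔⊂ : ∀ {m} {c b : Subset m} → c ≢ b → (c ⊆ b) ⇔ (c ⊂ b)
≢⇒⊆⇔⊂ {c = c} {b} c≢b = mk⇔ to proj₁
  where
  to : c ⊆ b → c ⊂ b
  to c⊆b = ⊆∧≢⇒⊂ c⊆b c≢b

module _ {m : ℕ} (M : Matroid m) where

  r-⊥ : r M ⊥ ≡ 0
  r-⊥ = ℕP.n≤0⇒n≡0 (subst (r M ⊥ ≤_) (∣⊥∣≡0 m) (r-bounded M ⊥))

  r≤m : ∀ X → r M X ≤ m
  r≤m X = ℕP.≤-trans (r-mono M ⊆⊤) (subst (r M ⊤ ≤_) (∣⊤∣≡n m) (r-bounded M ⊤))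

  flat-⊥ : Loopless M → IsFlat M ⊥
  flat-⊥ loopless e _ = begin-strict
    r M ⊥                ≡⟨ r-⊥ ⟩
    0                    <⟨ s≤s z≤n ⟩
    1                    ≡⟨ loopless e ⟨
    r M ⁅ e ⁆            ≤⟨ r-mono M (q⊆p∪q ⊥ ⁅ e ⁆) ⟩
    r M (⊥ ∪ ⁅ e ⁆)      ∎
    where open ℕP.≤-Reasoning

  flat-⊤ : IsFlat M ⊤
  flat-⊤ e e∉⊤ = contradiction ∈⊤ e∉⊤

  r-flat-⊂ : ∀ {a b} → IsFlat M a → a ⊂ b → r M a < r M b
  r-flat-⊂ {a} {b} flat-a (a⊆b , x , x∈b , x∉a) =
    ℕP.<-≤-trans (flat-a x x∉a) (r-mono M (∪-least a⊆b (⁅⁆⊆ x∈b)))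

  AddsNoRank : Subset m → Fin m → Set
  AddsNoRank Y e = r M (Y ∪ ⁅ e ⁆) ≤ r M Y

  addsNoRank-⊆ : ∀ {X Z} e → X ⊆ Z → AddsNoRank X e → AddsNoRank Z e
  addsNoRank-⊆ {X} {Z} e X⊆Z no-gain = ℕP.+-cancelʳ-≤ (r M X) (r M (Z ∪ ⁅ e ⁆)) (r M Z) (begin
    r M (Z ∪ ⁅ e ⁆) + r M X                              ≤⟨ ℕP.+-mono-≤ (r-mono M Z∪e⊆) (r-mono M X⊆) ⟩
    r M ((X ∪ ⁅ e ⁆) ∪ Z) + r M ((X ∪ ⁅ e ⁆) ∩ Z)        ≤⟨ r-submod M (X ∪ ⁅ e ⁆) Z ⟩
    r M (X ∪ ⁅ e ⁆) + r M Z                              ≤⟨ ℕP.+-monoˡ-≤ (r M Z) no-gain ⟩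
    r M X + r M Z                                        ≡⟨ ℕP.+-comm (r M X) (r M Z) ⟩
    r M Z + r M X                                        ∎)
    where
    open ℕP.≤-Reasoning
    Z∪e⊆ : Z ∪ ⁅ e ⁆ ⊆ (X ∪ ⁅ e ⁆) ∪ Z
    Z∪e⊆ = ∪-least (q⊆p∪q (X ∪ ⁅ e ⁆) Z) (p⊆p∪q Z ∘ q⊆p∪q X ⁅ e ⁆)
    X⊆ : X ⊆ (X ∪ ⁅ e ⁆) ∩ Z
    X⊆ x∈X = x∈p∩q⁺ (p⊆p∪q ⁅ e ⁆ x∈X , X⊆Z x∈X)

  addsNoRank-∪ : ∀ k Y S → ∣ S ∣ ≤ k → (∀ {e} → e ∈ S → AddsNoRank Y e) → r M (Y ∪ S) ≤ r M Y
  addsNoRank-∪ k Y S ∣S∣≤k no-gain with nonempty? S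
  ... | no S-empty = r-mono M (∪-least id (λ x∈S → contradiction (subst (_ ∈_) (Empty-unique S-empty) x∈S) ∉⊥))
  ... | yes (e , e∈S) with k
  ...   | zero   = contradiction (ℕP.<-≤-trans (x∈p⇒∣p-x∣<∣p∣ e∈S) ∣S∣≤k) ℕP.n≮0
  ...   | suc k′ = begin
    r M (Y ∪ S)                    ≤⟨ r-mono M Y∪S⊆ ⟩
    r M ((Y ∪ (S - e)) ∪ ⁅ e ⁆)    ≤⟨ addsNoRank-⊆ e (p⊆p∪q (S - e)) (no-gain e∈S) ⟩
    r M (Y ∪ (S - e))              ≤⟨ addsNoRank-∪ k′ Y (S - e) (ℕP.≤-pred (ℕP.<-≤-trans (x∈p⇒∣p-x∣<∣p∣ e∈S) ∣S∣≤k))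
                                        (no-gain ∘ p─q⊆p S ⁅ e ⁆) ⟩
    r M Y                          ∎
    where
    open ℕP.≤-Reasoning
    Y∪S⊆ : Y ∪ S ⊆ (Y ∪ (S - e)) ∪ ⁅ e ⁆
    Y∪S⊆ {y} y∈Y∪S with x∈p∪q⁻ Y S y∈Y∪S
    ... | inj₁ y∈Y = p⊆p∪q ⁅ e ⁆ (p⊆p∪q (S - e) y∈Y)
    ... | inj₂ y∈S with y Fin.≟ e
    ...   | yes refl = q⊆p∪q (Y ∪ (S - e)) ⁅ e ⁆ (x∈⁅x⁆ e)
    ...   | no  y≢e  = p⊆p∪q ⁅ e ⁆ (q⊆p∪q Y (S - e) (x∈p∧x≢y⇒x∈p-y y∈S y≢e))

  closure : Subset m → Subset m
  closure Y = tabulate λ e → does (r M (Y ∪ ⁅ e ⁆) ≤? r M Y)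

  ∈-closure⁻ : ∀ {Y e} → e ∈ closure Y → AddsNoRank Y e
  ∈-closure⁻ {Y} {e} e∈ = invert (subst (Reflects (AddsNoRank Y e))
    (trans (sym (lookup∘tabulate (λ e → does (r M (Y ∪ ⁅ e ⁆) ≤? r M Y)) e)) ([]=⇒lookup e∈))
    (proof (r M (Y ∪ ⁅ e ⁆) ≤? r M Y)))

  ∈-closure⁺ : ∀ {Y e} → AddsNoRank Y e → e ∈ closure Y
  ∈-closure⁺ {Y} {e} no-gain = lookup⇒[]= e (closure Y)
    (trans (lookup∘tabulate (λ e → does (r M (Y ∪ ⁅ e ⁆) ≤? r M Y)) e) (dec-true (r M (Y ∪ ⁅ e ⁆) ≤? r M Y) no-gain))

  ⊆-closure : ∀ Y → Y ⊆ closure Y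
  ⊆-closure Y y∈Y = ∈-closure⁺ (r-mono M (∪-least id (⁅⁆⊆ y∈Y)))

  r-closure : ∀ Y → r M (closure Y) ≤ r M Y
  r-closure Y = ℕP.≤-trans (r-mono M (q⊆p∪q Y (closure Y))) (addsNoRank-∪ m Y (closure Y) (∣p∣≤n (closure Y)) ∈-closure⁻)

  closure-flat : ∀ Y → IsFlat M (closure Y)
  closure-flat Y e e∉ = ℕP.≰⇒> λ no-gain → e∉ (∈-closure⁺ (begin
    r M (Y ∪ ⁅ e ⁆)               ≤⟨ r-mono M (∪-least (p⊆p∪q ⁅ e ⁆ ∘ ⊆-closure Y) (q⊆p∪q (closure Y) ⁅ e ⁆)) ⟩
    r M (closure Y ∪ ⁅ e ⁆)       ≤⟨ no-gain ⟩
    r M (closure Y)               ≤⟨ r-closure Y ⟩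
    r M Y                         ∎))
    where open ℕP.≤-Reasoning

  closure-least : ∀ {Y F} → Y ⊆ F → IsFlat M F → closure Y ⊆ F
  closure-least {Y} {F} Y⊆F flat-F {e} e∈ with e ∈? F
  ... | yes e∈F = e∈F
  ... | no  e∉F = contradiction (addsNoRank-⊆ e Y⊆F (∈-closure⁻ e∈)) (ℕP.<⇒≱ (flat-F e e∉F))

  maxChain-labels≢[] : ∀ {a b} {u : List ℕ} → IsFlat M a → a ⊂ b → length u ≡ r M b ∸ r M a → u ≢ []
  maxChain-labels≢[] flat-a a⊂b |u|≡ refl = ℕP.<⇒≱ (r-flat-⊂ flat-a a⊂b) (ℕP.m∸n≡0⇒m≤n (sym |u|≡))

  r-∪-⁅⁆ : ∀ Y x → r M (Y ∪ ⁅ x ⁆) ≤ suc (r M Y)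
  r-∪-⁅⁆ Y x = begin
    r M (Y ∪ ⁅ x ⁆)                         ≤⟨ ℕP.m≤m+n _ _ ⟩
    r M (Y ∪ ⁅ x ⁆) + r M (Y ∩ ⁅ x ⁆)       ≤⟨ r-submod M Y ⁅ x ⁆ ⟩
    r M Y + r M ⁅ x ⁆                       ≤⟨ ℕP.+-monoʳ-≤ (r M Y) (subst (r M ⁅ x ⁆ ≤_) (∣⁅x⁆∣≡1 x) (r-bounded M ⁅ x ⁆)) ⟩
    r M Y + 1                               ≡⟨ ℕP.+-comm (r M Y) 1 ⟩
    suc (r M Y)                             ∎
    where open ℕP.≤-Reasoning

  -- The closure of a ∪ {x}, for x ∈ b - a, lies strictly between a and b, so it is b.
  r-cover : ∀ {a b} → Cover M a b → r M b ≡ suc (r M a)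
  r-cover {a} {b} (flat-a , flat-b , a⊂b@(a⊆b , x , x∈b , x∉a) , no-between) =
    ℕP.≤-antisym (begin
      r M b                  ≡⟨ cong (r M) (⊆-antisym c⊆b b⊆c) ⟨
      r M c                  ≤⟨ r-closure (a ∪ ⁅ x ⁆) ⟩
      r M (a ∪ ⁅ x ⁆)        ≤⟨ r-∪-⁅⁆ a x ⟩
      suc (r M a)            ∎)
      (r-flat-⊂ flat-a a⊂b)
    where
    open ℕP.≤-Reasoning
    c = closure (a ∪ ⁅ x ⁆)
    c⊆b : c ⊆ b
    c⊆b = closure-least (∪-least a⊆b (⁅⁆⊆ x∈b)) flat-b
    a⊂c : a ⊂ c
    a⊂c = ⊆-closure _ ∘ p⊆p∪q ⁅ x ⁆ , x , ⊆-closure _ (q⊆p∪q a ⁅ x ⁆ (x∈⁅x⁆ x)) , x∉a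
    b⊆c : b ⊆ c
    b⊆c {y} y∈b with y ∈? c
    ... | yes y∈c = y∈c
    ... | no  y∉c = contradiction c⊂b (no-between c (closure-flat _) a⊂c)
      where
      c⊂b : c ⊂ b
      c⊂b = c⊆b , y , y∈b , y∉c

infix 4 _≟ₛ_ _≟ₗ_

_≟ₛ_ : ∀ {m} → DecidableEquality (Subset m)
_≟ₛ_ = Vec.≡-dec Bool._≟_

_≟ₗ_ : ∀ {m} → DecidableEquality (List (Subset m))
_≟ₗ_ = List.≡-dec _≟ₛ_

∑-allSubsets-≡ : ∀ m (a : Subset m) (g : Subset m → Poly) → ∑ (allSubsets m) (λ c → when (does (a ≟ₛ c)) (g c)) ≈ g a
∑-allSubsets-≡ zero    []      g = ≈-reflexive (+ₚ-identityʳ (g []))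
∑-allSubsets-≡ (suc m) (x ∷ a) g = begin
  ∑ (map (inside ∷_) (allSubsets m) ++ map (outside ∷_) (allSubsets m)) f
    ≈⟨ ∑-++ (map (inside ∷_) (allSubsets m)) _ f ⟩
  ∑ (map (inside ∷_) (allSubsets m)) f +ₚ ∑ (map (outside ∷_) (allSubsets m)) f
    ≈⟨ +ₚ-cong (∑-map (inside ∷_) (allSubsets m) f) (∑-map (outside ∷_) (allSubsets m) f) ⟩
  ∑ (allSubsets m) (f ∘ (inside ∷_)) +ₚ ∑ (allSubsets m) (f ∘ (outside ∷_))
    ≈⟨ by-cases x ⟩
  g (x ∷ a) ∎
  where
  open ≈-Reasoning
  f : Subset (suc m) → Poly
  f c = when (does (x ∷ a ≟ₛ c)) (g c)
  head-≡ : ∀ {y} c → does (y ∷ a ≟ₛ y ∷ c) ≡ does (a ≟ₛ c)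
  head-≡ {y} c = does-⇔ ∷-cancel (y ∷ a ≟ₛ y ∷ c) (a ≟ₛ c)
    where
    ∷-cancel : (y ∷ a ≡ y ∷ c) ⇔ (a ≡ c)
    ∷-cancel = mk⇔ Vec.∷-injectiveʳ (cong (y ∷_))
  head-≢ : ∀ {y z} c → y ≢ z → does (y ∷ a ≟ₛ z ∷ c) ≡ false
  head-≢ {y} {z} c y≢z = dec-false (y ∷ a ≟ₛ z ∷ c) (y≢z ∘ Vec.∷-injectiveˡ)
  same : ∀ y → ∑ (allSubsets m) (λ c → when (does (y ∷ a ≟ₛ y ∷ c)) (g (y ∷ c))) ≈ g (y ∷ a)
  same y = ≈-trans (∑-cong (allSubsets m) λ c → ≈-reflexive (cong (λ b → when b (g (y ∷ c))) (head-≡ {y} c)))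
                   (∑-allSubsets-≡ m a (g ∘ (y ∷_)))
  other : ∀ y z → y ≢ z → ∑ (allSubsets m) (λ c → when (does (y ∷ a ≟ₛ z ∷ c)) (g (z ∷ c))) ≈ 0ₚ
  other y z y≢z = ∑-zero (allSubsets m) λ c → ≈-reflexive (cong (λ b → when b (g (z ∷ c))) (head-≢ {y} {z} c y≢z))
  by-cases : ∀ x → ∑ (allSubsets m) (λ c → when (does (x ∷ a ≟ₛ inside ∷ c)) (g (inside ∷ c)))
                   +ₚ ∑ (allSubsets m) (λ c → when (does (x ∷ a ≟ₛ outside ∷ c)) (g (outside ∷ c))) ≈ g (x ∷ a)
  by-cases true  = ≈-trans (+ₚ-cong (same true) (other true false λ ())) (≈-reflexive (+ₚ-identityʳ _))
  by-cases false = +ₚ-cong (other false true λ ()) (same false)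

∑-allSubsets-≡ˡ : ∀ m (a : Subset m) (g : Subset m → Poly) → ∑ (allSubsets m) (λ c → when (does (c ≟ₛ a)) (g c)) ≈ g a
∑-allSubsets-≡ˡ m a g = ≈-trans
  (∑-cong (allSubsets m) λ c → ≈-reflexive (cong (λ b → when b (g c)) (does-⇔ (mk⇔ sym sym) (c ≟ₛ a) (a ≟ₛ c))))
  (∑-allSubsets-≡ m a g)

∑-listsOfLength-≡ : ∀ m L (mid₀ : List (Subset m)) (g : List (Subset m) → Poly) → length mid₀ ≡ L →
                    ∑ (listsOfLength (allSubsets m) L) (λ mid → when (does (mid₀ ≟ₗ mid)) (g mid)) ≈ g mid₀
∑-listsOfLength-≡ m zero    []        g refl = ≈-reflexive (+ₚ-identityʳ (g []))
∑-listsOfLength-≡ m (suc L) (c₀ ∷ t₀) g refl = begin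
  ∑ (concatMap (λ c → map (c ∷_) (listsOfLength (allSubsets m) L)) (allSubsets m)) f
    ≈⟨ ∑-concatMap (λ c → map (c ∷_) (listsOfLength (allSubsets m) L)) (allSubsets m) f ⟩
  ∑ (allSubsets m) (λ c → ∑ (map (c ∷_) (listsOfLength (allSubsets m) L)) f)
    ≈⟨ ∑-cong (allSubsets m) (λ c → ≈-trans (∑-map (c ∷_) (listsOfLength (allSubsets m) L) f)
         (≈-trans (∑-cong (listsOfLength (allSubsets m) L) λ t → ≈-reflexive
                     (trans (cong (λ b → when b (g (c ∷ t))) (split c t)) (when-∧ (does (c₀ ≟ₛ c)) _ _)))
                  (∑-when (listsOfLength (allSubsets m) L) (does (c₀ ≟ₛ c)) _))) ⟩
  ∑ (allSubsets m) (λ c → when (does (c₀ ≟ₛ c)) (∑ (listsOfLength (allSubsets m) L) (λ t → when (does (t₀ ≟ₗ t)) (g (c ∷ t)))))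
    ≈⟨ ∑-allSubsets-≡ m c₀ _ ⟩
  ∑ (listsOfLength (allSubsets m) L) (λ t → when (does (t₀ ≟ₗ t)) (g (c₀ ∷ t)))
    ≈⟨ ∑-listsOfLength-≡ m L t₀ (g ∘ (c₀ ∷_)) refl ⟩
  g (c₀ ∷ t₀) ∎
  where
  open ≈-Reasoning
  f : List (Subset m) → Poly
  f mid = when (does (c₀ ∷ t₀ ≟ₗ mid)) (g mid)
  split : ∀ c t → does (c₀ ∷ t₀ ≟ₗ c ∷ t) ≡ does (c₀ ≟ₛ c) ∧ does (t₀ ≟ₗ t)
  split c t with c₀ ≟ₛ c | t₀ ≟ₗ t
  ... | yes refl | yes refl = refl
  ... | yes _    | no _     = refl
  ... | no _     | _        = refl

module _ {m : ℕ} (M : Matroid m) (lab : Subset m → Subset m → ℕ) where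

  chainSum : ℕ → Subset m → Subset m → (List ℕ → Poly) → Poly
  chainSum zero    a b W = when (does (a ≟ₛ b)) (W [])
  chainSum (suc n) a b W = ∑ (allSubsets m) λ c → when (does (cover? M a c)) (chainSum n c b (W ∘ (lab a c ∷_)))

  maxChainSum : Subset m → Subset m → (List ℕ → Poly) → Poly
  maxChainSum a b = chainSum (r M b ∸ r M a) a b

  chainSum-cong-length : ∀ n a b {W W′ : List ℕ → Poly} → (∀ u → length u ≡ n → W u ≈ W′ u) →
                         chainSum n a b W ≈ chainSum n a b W′
  chainSum-cong-length zero    a b W≈W′ = when-cong (does (a ≟ₛ b)) (W≈W′ [] refl)
  chainSum-cong-length (suc n) a b W≈W′ = ∑-cong (allSubsets m) λ c → when-cong (does (cover? M a c))
    (chainSum-cong-length n c b λ u |u|≡n → W≈W′ (lab a c ∷ u) (cong suc |u|≡n))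

  chainSum-cong : ∀ n a b {W W′ : List ℕ → Poly} → (∀ u → W u ≈ W′ u) → chainSum n a b W ≈ chainSum n a b W′
  chainSum-cong n a b W≈W′ = chainSum-cong-length n a b (λ u _ → W≈W′ u)

  chainSum-zero : ∀ n a b {W : List ℕ → Poly} → (∀ u → length u ≡ n → W u ≈ 0ₚ) → chainSum n a b W ≈ 0ₚ
  chainSum-zero zero    a b W≈0 = when-zero (does (a ≟ₛ b)) (W≈0 [] refl)
  chainSum-zero (suc n) a b W≈0 = ∑-zero (allSubsets m) λ c → when-zero (does (cover? M a c))
    (chainSum-zero n c b λ u |u|≡n → W≈0 (lab a c ∷ u) (cong suc |u|≡n))

  chainSum-*ₚˡ : ∀ n a b s W → chainSum n a b (λ u → s *ₚ W u) ≈ s *ₚ chainSum n a b W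
  chainSum-*ₚˡ zero    a b s W = ≈-sym (when-*ₚʳ (does (a ≟ₛ b)) (W []) s)
  chainSum-*ₚˡ (suc n) a b s W = ≈-trans
    (∑-cong (allSubsets m) λ c → ≈-trans (when-cong (does (cover? M a c)) (chainSum-*ₚˡ n c b s _))
                                         (≈-sym (when-*ₚʳ (does (cover? M a c)) _ s)))
    (∑-*ₚˡ (allSubsets m) s _)

  chainSum-*ₚʳ : ∀ n a b s W → chainSum n a b (λ u → W u *ₚ s) ≈ chainSum n a b W *ₚ s
  chainSum-*ₚʳ n a b s W = begin
    chainSum n a b (λ u → W u *ₚ s)   ≈⟨ chainSum-cong n a b (λ u → *ₚ-comm (W u) s) ⟩
    chainSum n a b (λ u → s *ₚ W u)   ≈⟨ chainSum-*ₚˡ n a b s W ⟩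
    s *ₚ chainSum n a b W             ≈⟨ *ₚ-comm s _ ⟩
    chainSum n a b W *ₚ s             ∎
    where open ≈-Reasoning

  chainSum-+ₚ : ∀ n a b W W′ → chainSum n a b (λ u → W u +ₚ W′ u) ≈ chainSum n a b W +ₚ chainSum n a b W′
  chainSum-+ₚ zero    a b W W′ = when-+ₚ (does (a ≟ₛ b)) (W []) (W′ [])
  chainSum-+ₚ (suc n) a b W W′ = ≈-trans
    (∑-cong (allSubsets m) λ c → ≈-trans (when-cong (does (cover? M a c)) (chainSum-+ₚ n c b _ _))
                                         (when-+ₚ (does (cover? M a c)) _ _))
    (∑-+ₚ (allSubsets m) _ _)

  maxChainSum-cong : ∀ a b {W W′ : List ℕ → Poly} → (∀ u → length u ≡ r M b ∸ r M a → W u ≈ W′ u) →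
                     maxChainSum a b W ≈ maxChainSum a b W′
  maxChainSum-cong a b = chainSum-cong-length (r M b ∸ r M a) a b

  maxChainSum-zero : ∀ a b {W : List ℕ → Poly} → (∀ u → length u ≡ r M b ∸ r M a → W u ≈ 0ₚ) → maxChainSum a b W ≈ 0ₚ
  maxChainSum-zero a b = chainSum-zero (r M b ∸ r M a) a b

  maxChainSum-*ₚˡ : ∀ a b s W → maxChainSum a b (λ u → s *ₚ W u) ≈ s *ₚ maxChainSum a b W
  maxChainSum-*ₚˡ a b = chainSum-*ₚˡ (r M b ∸ r M a) a b

  maxChainSum-self : ∀ c W → maxChainSum c c W ≈ W []
  maxChainSum-self c W rewrite ℕP.n∸n≡0 (r M c) | dec-true (c ≟ₛ c) refl = ≈-refl

  chainSum-rank : ∀ n a b W → r M b ≢ n + r M a → chainSum n a b W ≈ 0ₚ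
  chainSum-rank zero    a b W rb≢ra with a ≟ₛ b
  ... | yes refl = contradiction refl rb≢ra
  ... | no  _    = ≈-refl
  chainSum-rank (suc n) a b W rb≢ = ∑-zero (allSubsets m) λ c → by-cases c (cover? M a c)
    where
    by-cases : ∀ c (a⋖c? : Dec (Cover M a c)) → when (does a⋖c?) (chainSum n c b (W ∘ (lab a c ∷_))) ≈ 0ₚ
    by-cases c (yes a⋖c) = chainSum-rank n c b _ λ rb≡ →
      rb≢ (trans rb≡ (trans (cong (λ k → n + k) (r-cover M a⋖c)) (ℕP.+-suc n (r M a))))
    by-cases c (no _)    = ≈-refl

  chainSum-rank-≰ : ∀ n a b W → ¬ r M a ≤ r M b → chainSum n a b W ≈ 0ₚ
  chainSum-rank-≰ n a b W ra≰rb = chainSum-rank n a b W λ rb≡ → ra≰rb (subst (r M a ≤_) (sym rb≡) (ℕP.m≤n+m (r M a) n))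

  chainSum-⊈ : ∀ n a b W → ¬ a ⊆ b → chainSum n a b W ≈ 0ₚ
  chainSum-⊈ zero    a b W a⊈b with a ≟ₛ b
  ... | yes refl = contradiction (λ {x} → id) a⊈b
  ... | no  _    = ≈-refl
  chainSum-⊈ (suc n) a b W a⊈b = ∑-zero (allSubsets m) λ c → by-cases c (cover? M a c)
    where
    by-cases : ∀ c (a⋖c? : Dec (Cover M a c)) → when (does a⋖c?) (chainSum n c b (W ∘ (lab a c ∷_))) ≈ 0ₚ
    by-cases c (yes (_ , _ , (a⊆c , _) , _)) = chainSum-⊈ n c b _ λ c⊆b → a⊈b (c⊆b ∘ a⊆c)
    by-cases c (no _)                        = ≈-refl

  chainSum-nonflat : ∀ n a b W → IsFlat M a → ¬ IsFlat M b → chainSum n a b W ≈ 0ₚ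
  chainSum-nonflat zero    a b W flat-a nonflat-b with a ≟ₛ b
  ... | yes refl = contradiction flat-a nonflat-b
  ... | no  _    = ≈-refl
  chainSum-nonflat (suc n) a b W _ nonflat-b = ∑-zero (allSubsets m) λ c → by-cases c (cover? M a c)
    where
    by-cases : ∀ c (a⋖c? : Dec (Cover M a c)) → when (does a⋖c?) (chainSum n c b (W ∘ (lab a c ∷_))) ≈ 0ₚ
    by-cases c (yes (_ , flat-c , _)) = chainSum-nonflat n c b _ flat-c nonflat-b
    by-cases c (no _)                 = ≈-refl

  chainSum-splitSum : ∀ N a b F →
    ∑ (upTo (suc N)) (λ p → ∑ (allSubsets m) λ c → chainSum p a c (λ u → chainSum (N ∸ p) c b (F u)))
      ≈ chainSum N a b (splitSum F)
  chainSum-splitSum zero    a b F = ≈-trans (≈-reflexive (+ₚ-identityʳ _))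
    (∑-allSubsets-≡ m a (λ c → when (does (c ≟ₛ b)) (F [] [])))
  chainSum-splitSum (suc N) a b F = begin
    ∑ (upTo (suc (suc N))) G
      ≈⟨ ∑-upTo-suc (suc N) G ⟩
    G 0 +ₚ ∑ (upTo (suc N)) (G ∘ suc)
      ≈⟨ +ₚ-cong (∑-allSubsets-≡ m a (λ c → chainSum (suc N) c b (F []))) shorter-first-part ⟩
    chainSum (suc N) a b (F []) +ₚ ∑ (allSubsets m) (λ d → when (does (cover? M a d)) (chainSum N d b (splitSum (F′ d))))
      ≈⟨ ∑-+ₚ (allSubsets m) _ _ ⟨
    ∑ (allSubsets m) (λ d → when (does (cover? M a d)) (chainSum N d b (F [] ∘ (lab a d ∷_)))
                            +ₚ when (does (cover? M a d)) (chainSum N d b (splitSum (F′ d))))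
      ≈⟨ ∑-cong (allSubsets m) (λ d → ≈-trans (≈-sym (when-+ₚ (does (cover? M a d)) _ _))
                                               (when-cong (does (cover? M a d)) (≈-sym (chainSum-+ₚ N d b _ _)))) ⟩
    chainSum (suc N) a b (splitSum F) ∎
    where
    open ≈-Reasoning
    G : ℕ → Poly
    G p = ∑ (allSubsets m) λ c → chainSum p a c (λ u → chainSum (suc N ∸ p) c b (F u))
    F′ : Subset m → List ℕ → List ℕ → Poly
    F′ d u v = F (lab a d ∷ u) v
    shorter-first-part : ∑ (upTo (suc N)) (G ∘ suc) ≈ ∑ (allSubsets m) (λ d → when (does (cover? M a d)) (chainSum N d b (splitSum (F′ d))))
    shorter-first-part = begin
      ∑ (upTo (suc N)) (G ∘ suc)
        ≈⟨ ∑-cong (upTo (suc N)) (λ p → ≈-trans (∑-swap (allSubsets m) (allSubsets m) _)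
                                                (∑-cong (allSubsets m) λ d → ∑-when (allSubsets m) (does (cover? M a d)) _)) ⟩
      ∑ (upTo (suc N)) (λ p → ∑ (allSubsets m) λ d → when (does (cover? M a d))
          (∑ (allSubsets m) λ c → chainSum p d c (λ u → chainSum (N ∸ p) c b (F′ d u))))
        ≈⟨ ∑-swap (upTo (suc N)) (allSubsets m) _ ⟩
      ∑ (allSubsets m) (λ d → ∑ (upTo (suc N)) λ p → when (does (cover? M a d))
          (∑ (allSubsets m) λ c → chainSum p d c (λ u → chainSum (N ∸ p) c b (F′ d u))))
        ≈⟨ ∑-cong (allSubsets m) (λ d → ≈-trans (∑-when (upTo (suc N)) (does (cover? M a d)) _)
                                                (when-cong (does (cover? M a d)) (chainSum-splitSum N d b (F′ d)))) ⟩
      ∑ (allSubsets m) (λ d → when (does (cover? M a d)) (chainSum N d b (splitSum (F′ d)))) ∎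

  ∑-chainSum-*ₚ : ∀ N a b c U V → N + r M a ≡ r M b →
    ∑ (upTo (suc N)) (λ p → chainSum p a c U *ₚ chainSum (N ∸ p) c b V) ≈ maxChainSum a c U *ₚ maxChainSum c b V
  ∑-chainSum-*ₚ N a b c U V N+ra≡rb = by-cases (r M a ≤? r M c) (r M c ≤? r M b)
    where
    f : ℕ → Poly
    f p = chainSum p a c U *ₚ chainSum (N ∸ p) c b V
    by-cases : Dec (r M a ≤ r M c) → Dec (r M c ≤ r M b) → ∑ (upTo (suc N)) f ≈ maxChainSum a c U *ₚ maxChainSum c b V
    by-cases (no ra≰rc) _ = ≈-trans
      (∑-upTo-zero (suc N) f λ p _ → *ₚ-absorbˡ (chainSum p a c U) _ (chainSum-rank-≰ p a c U ra≰rc))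
      (≈-sym (*ₚ-absorbˡ (maxChainSum a c U) _ (chainSum-rank-≰ (r M c ∸ r M a) a c U ra≰rc)))
    by-cases (yes _) (no rc≰rb) = ≈-trans
      (∑-upTo-zero (suc N) f λ p _ → *ₚ-absorbʳ (chainSum p a c U) _ (chainSum-rank-≰ (N ∸ p) c b V rc≰rb))
      (≈-sym (*ₚ-absorbʳ (maxChainSum a c U) _ (chainSum-rank-≰ (r M b ∸ r M c) c b V rc≰rb)))
    by-cases (yes ra≤rc) (yes rc≤rb) = ≈-trans
      (∑-upTo-single (suc N) f p₀ (s≤s p₀≤N) λ p _ p≢p₀ → *ₚ-absorbˡ (chainSum p a c U) _ (chainSum-rank p a c U λ rc≡ →
        p≢p₀ (trans (sym (ℕP.m+n∸n≡m p (r M a))) (cong (_∸ r M a) (sym rc≡)))))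
      (*ₚ-congˡ (chainSum p₀ a c U) (≈-reflexive (cong (λ k → chainSum k c b V) N∸p₀≡)))
      where
      p₀ = r M c ∸ r M a
      N≡ : N ≡ r M b ∸ r M a
      N≡ = trans (sym (ℕP.m+n∸n≡m N (r M a))) (cong (_∸ r M a) N+ra≡rb)
      p₀≤N : p₀ ≤ N
      p₀≤N = subst (p₀ ≤_) (sym N≡) (ℕP.∸-monoˡ-≤ (r M a) rc≤rb)
      N∸p₀≡ : N ∸ p₀ ≡ r M b ∸ r M c
      N∸p₀≡ = begin
        N ∸ p₀                                  ≡⟨ cong (_∸ p₀) N≡ ⟩
        (r M b ∸ r M a) ∸ (r M c ∸ r M a)       ≡⟨ ℕP.∸-+-assoc (r M b) (r M a) (r M c ∸ r M a) ⟩
        r M b ∸ (r M a + (r M c ∸ r M a))       ≡⟨ cong (r M b ∸_) (ℕP.m+[n∸m]≡n ra≤rc) ⟩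
        r M b ∸ r M c                           ∎
        where open ≡-Reasoning

  maxChainSum-concat : ∀ a b U V → r M a ≤ r M b →
    ∑ (allSubsets m) (λ c → maxChainSum a c U *ₚ maxChainSum c b V) ≈ maxChainSum a b (splitSum (λ u v → U u *ₚ V v))
  maxChainSum-concat a b U V ra≤rb = begin
    ∑ (allSubsets m) (λ c → maxChainSum a c U *ₚ maxChainSum c b V)
      ≈⟨ ∑-cong (allSubsets m) (λ c → ∑-chainSum-*ₚ N a b c U V (ℕP.m∸n+n≡m ra≤rb)) ⟨
    ∑ (allSubsets m) (λ c → ∑ (upTo (suc N)) λ p → chainSum p a c U *ₚ chainSum (N ∸ p) c b V)
      ≈⟨ ∑-swap (allSubsets m) (upTo (suc N)) _ ⟩
    ∑ (upTo (suc N)) (λ p → ∑ (allSubsets m) λ c → chainSum p a c U *ₚ chainSum (N ∸ p) c b V)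
      ≈⟨ ∑-cong (upTo (suc N)) (λ p → ∑-cong (allSubsets m) λ c → ≈-trans
           (≈-sym (chainSum-*ₚʳ p a c (chainSum (N ∸ p) c b V) U))
           (chainSum-cong p a c λ u → ≈-sym (chainSum-*ₚˡ (N ∸ p) c b (U u) V))) ⟩
    ∑ (upTo (suc N)) (λ p → ∑ (allSubsets m) λ c → chainSum p a c (λ u → chainSum (N ∸ p) c b (λ v → U u *ₚ V v)))
      ≈⟨ chainSum-splitSum N a b (λ u v → U u *ₚ V v) ⟩
    chainSum N a b (splitSum (λ u v → U u *ₚ V v)) ∎
    where
    open ≈-Reasoning
    N = r M b ∸ r M a

  chainSum-listsOfLength : ∀ L a b W → chainSum (suc L) a b W ≈
    ∑ (listsOfLength (allSubsets m) L) (λ mid → when (does (linked? (cover? M) (a ∷ mid ++ [ b ])))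
                                                      (W (labels M lab (a ∷ mid ++ [ b ]))))
  chainSum-listsOfLength zero a b W = begin
    ∑ (allSubsets m) (λ c → when (does (cover? M a c)) (when (does (c ≟ₛ b)) (W (lab a c ∷ []))))
      ≈⟨ ∑-cong (allSubsets m) (λ c → ≈-reflexive (when-comm (does (cover? M a c)) (does (c ≟ₛ b)) _)) ⟩
    ∑ (allSubsets m) (λ c → when (does (c ≟ₛ b)) (when (does (cover? M a c)) (W (lab a c ∷ []))))
      ≈⟨ ∑-allSubsets-≡ˡ m b (λ c → when (does (cover? M a c)) (W (lab a c ∷ []))) ⟩
    when (does (cover? M a b)) (W (lab a b ∷ []))
      ≡⟨ cong (λ t → when t (W (lab a b ∷ []))) (∧-identityʳ _) ⟨
    when (does (cover? M a b) ∧ true) (W (lab a b ∷ []))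
      ≡⟨ +ₚ-identityʳ _ ⟨
    when (does (cover? M a b) ∧ true) (W (lab a b ∷ [])) +ₚ 0ₚ ∎
    where open ≈-Reasoning
  chainSum-listsOfLength (suc L) a b W = ≈-sym (begin
    ∑ (concatMap (λ x → map (x ∷_) (listsOfLength (allSubsets m) L)) (allSubsets m)) f
      ≈⟨ ∑-concatMap (λ x → map (x ∷_) (listsOfLength (allSubsets m) L)) (allSubsets m) f ⟩
    ∑ (allSubsets m) (λ x → ∑ (map (x ∷_) (listsOfLength (allSubsets m) L)) f)
      ≈⟨ ∑-cong (allSubsets m) (λ x → ≈-trans (∑-map (x ∷_) (listsOfLength (allSubsets m) L) f)
           (≈-trans (∑-cong (listsOfLength (allSubsets m) L) λ mid → ≈-reflexive (when-∧ (does (cover? M a x)) _ _))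
                    (∑-when (listsOfLength (allSubsets m) L) (does (cover? M a x)) _))) ⟩
    ∑ (allSubsets m) (λ x → when (does (cover? M a x)) (∑ (listsOfLength (allSubsets m) L) λ mid →
        when (does (linked? (cover? M) (x ∷ mid ++ [ b ]))) (W (lab a x ∷ labels M lab (x ∷ mid ++ [ b ])))))
      ≈⟨ ∑-cong (allSubsets m) (λ x → when-cong (does (cover? M a x)) (≈-sym (chainSum-listsOfLength L x b (W ∘ (lab a x ∷_))))) ⟩
    chainSum (suc (suc L)) a b W ∎)
    where
    open ≈-Reasoning
    f : List (Subset m) → Poly
    f mid = when (does (linked? (cover? M) (a ∷ mid ++ [ b ]))) (W (labels M lab (a ∷ mid ++ [ b ])))

  r-coverChain : ∀ c mid b → Linked (Cover M) (c ∷ mid ++ [ b ]) → r M b ≡ suc (length mid) + r M c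
  r-coverChain c []        b (c⋖b ∷ _)    = r-cover M c⋖b
  r-coverChain c (x ∷ mid) b (c⋖x ∷ rest) = begin
    r M b                             ≡⟨ r-coverChain x mid b rest ⟩
    suc (length mid) + r M x          ≡⟨ cong (λ k → suc (length mid) + k) (r-cover M c⋖x) ⟩
    suc (length mid) + suc (r M c)    ≡⟨ ℕP.+-suc (suc (length mid)) (r M c) ⟩
    suc (length (x ∷ mid)) + r M c    ∎
    where open ≡-Reasoning

  descentSum≈maxChainSum : 1 ≤ rank M → descentSum M lab ≈ maxChainSum ⊥ ⊤ descentWeight
  descentSum≈maxChainSum 1≤r⊤ = begin
    ∑ (filter (λ F → goodDes? (Des M lab F)) (maximalChains M)) weight
      ≈⟨ ∑-filter (λ F → goodDes? (Des M lab F)) (maximalChains M) weight ⟩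
    ∑ (maximalChains M) (Ψ ∘ labels M lab)
      ≈⟨ ∑-filter (linked? (cover? M)) (candidates m) (Ψ ∘ labels M lab) ⟩
    ∑ (candidates m) (λ F → when (does (linked? (cover? M) F)) (Ψ (labels M lab F)))
      ≈⟨ ∑-concatMap (λ L → map (λ mid → ⊥ ∷ mid ++ [ ⊤ ]) (listsOfLength (allSubsets m) L)) (upTo (suc m)) _ ⟩
    ∑ (upTo (suc m)) (λ L → ∑ (map (λ mid → ⊥ ∷ mid ++ [ ⊤ ]) (listsOfLength (allSubsets m) L)) _)
      ≈⟨ ∑-cong (upTo (suc m)) (λ L → ≈-trans (∑-map (λ mid → ⊥ ∷ mid ++ [ ⊤ ]) (listsOfLength (allSubsets m) L) _)
                                               (≈-sym (chainSum-listsOfLength L ⊥ ⊤ Ψ))) ⟩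
    ∑ (upTo (suc m)) (λ L → chainSum (suc L) ⊥ ⊤ Ψ)
      ≈⟨ ∑-upTo-single (suc m) (λ L → chainSum (suc L) ⊥ ⊤ Ψ) (r M ⊤ ∸ 1) (s≤s (ℕP.≤-trans (ℕP.m∸n≤m (r M ⊤) 1) (r≤m M ⊤)))
           (λ L _ L≢ → chainSum-rank (suc L) ⊥ ⊤ Ψ (L≢ ∘ length-of-maximal L)) ⟩
    chainSum (suc (r M ⊤ ∸ 1)) ⊥ ⊤ Ψ
      ≡⟨ cong (λ n → chainSum n ⊥ ⊤ Ψ) (trans (trans (ℕP.+-comm 1 (r M ⊤ ∸ 1)) (ℕP.m∸n+n≡m 1≤r⊤)) r⊤≡r⊤∸r⊥) ⟩
    maxChainSum ⊥ ⊤ Ψ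
      ≈⟨ maxChainSum-cong ⊥ ⊤ (λ u |u|≡ → ≈-reflexive (cong (λ n → guardedMonomial (does (goodDes? (descents u))) (length (descents u))
                                                                       (n ∸ 1 ∸ 2 ℕ.* length (descents u)))
                                                             (trans r⊤≡r⊤∸r⊥ (sym |u|≡)))) ⟩
    maxChainSum ⊥ ⊤ descentWeight ∎
    where
    open ≈-Reasoning
    r⊤≡r⊤∸r⊥ : r M ⊤ ≡ r M ⊤ ∸ r M ⊥
    r⊤≡r⊤∸r⊥ = cong (r M ⊤ ∸_) (sym (r-⊥ M))
    length-of-maximal : ∀ L → r M ⊤ ≡ suc L + r M ⊥ → L ≡ r M ⊤ ∸ 1
    length-of-maximal L r⊤≡ = sym (trans (cong (_∸ 1) r⊤≡) (trans (cong (λ k → L + k) (r-⊥ M)) (ℕP.+-identityʳ L)))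
    weight : List (Subset m) → Poly
    weight F = (X ^ₚ des M lab F) *ₚ (X+1 ^ₚ (rank M ∸ 1 ∸ 2 ℕ.* des M lab F))
    Ψ : List ℕ → Poly
    Ψ ℓ = guardedMonomial (does (goodDes? (descents ℓ))) (length (descents ℓ)) (rank M ∸ 1 ∸ 2 ℕ.* length (descents ℓ))

module _ {m : ℕ} (M : Matroid m) where

  isFlagChain? : (C : List (Subset m)) → Dec (IsFlagChain M C)
  isFlagChain? C = All.all? (isFlat? M) C ×-dec linked? _⊂?_ C

  flagChainWeight : List (Subset m) → Poly
  flagChainWeight C = prodₚ (map (λ { (a , b) → redCharPoly M a b }) (steps M C))

  flagChainSum : ℕ → Subset m → Subset m → Poly
  flagChainSum L a b = ∑ (listsOfLength (allSubsets m) L) λ mid →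
    when (does (isFlagChain? (a ∷ mid ++ [ b ]))) (flagChainWeight (a ∷ mid ++ [ b ]))

  chowPoly≈ : chowPoly M ≈ ∑ (upTo (suc m)) (λ L → flagChainSum L ⊥ ⊤)
  chowPoly≈ = begin
    ∑ (flagChains M) flagChainWeight
      ≈⟨ ∑-filter isFlagChain? (candidates m) flagChainWeight ⟩
    ∑ (candidates m) (λ C → when (does (isFlagChain? C)) (flagChainWeight C))
      ≈⟨ ∑-concatMap (λ L → map (λ mid → ⊥ ∷ mid ++ [ ⊤ ]) (listsOfLength (allSubsets m) L)) (upTo (suc m)) _ ⟩
    ∑ (upTo (suc m)) (λ L → ∑ (map (λ mid → ⊥ ∷ mid ++ [ ⊤ ]) (listsOfLength (allSubsets m) L)) _)
      ≈⟨ ∑-cong (upTo (suc m)) (λ L → ∑-map (λ mid → ⊥ ∷ mid ++ [ ⊤ ]) (listsOfLength (allSubsets m) L) _) ⟩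
    ∑ (upTo (suc m)) (λ L → flagChainSum L ⊥ ⊤) ∎
    where open ≈-Reasoning

  flagChainSum-suc : ∀ L a b → flagChainSum (suc L) a b ≈
    ∑ (allSubsets m) (λ x → when (does (isFlat? M a) ∧ does (a ⊂? x)) (redCharPoly M a x *ₚ flagChainSum L x b))
  flagChainSum-suc L a b = begin
    ∑ (concatMap (λ x → map (x ∷_) (listsOfLength (allSubsets m) L)) (allSubsets m)) f
      ≈⟨ ∑-concatMap (λ x → map (x ∷_) (listsOfLength (allSubsets m) L)) (allSubsets m) f ⟩
    ∑ (allSubsets m) (λ x → ∑ (map (x ∷_) (listsOfLength (allSubsets m) L)) f)
      ≈⟨ ∑-cong (allSubsets m) (λ x → ≈-trans (∑-map (x ∷_) (listsOfLength (allSubsets m) L) f) (step x)) ⟩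
    ∑ (allSubsets m) (λ x → when (does (isFlat? M a) ∧ does (a ⊂? x)) (redCharPoly M a x *ₚ flagChainSum L x b)) ∎
    where
    open ≈-Reasoning
    f : List (Subset m) → Poly
    f mid = when (does (isFlagChain? (a ∷ mid ++ [ b ]))) (flagChainWeight (a ∷ mid ++ [ b ]))
    step : ∀ x → ∑ (listsOfLength (allSubsets m) L) (f ∘ (x ∷_)) ≈
                 when (does (isFlat? M a) ∧ does (a ⊂? x)) (redCharPoly M a x *ₚ flagChainSum L x b)
    step x = begin
      ∑ (listsOfLength (allSubsets m) L) (f ∘ (x ∷_))
        ≈⟨ ∑-cong (listsOfLength (allSubsets m) L) (λ mid → ≈-trans
             (≈-reflexive (trans (cong (λ t → when t (flagChainWeight (a ∷ x ∷ mid ++ [ b ])))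
                                       (∧-interchange (does (isFlat? M a)) _ (does (a ⊂? x)) _))
                                 (when-∧ (does (isFlat? M a) ∧ does (a ⊂? x)) _ _)))
             (when-cong (does (isFlat? M a) ∧ does (a ⊂? x))
               (≈-sym (when-*ₚʳ (does (isFlagChain? (x ∷ mid ++ [ b ]))) (flagChainWeight (x ∷ mid ++ [ b ])) (redCharPoly M a x))))) ⟩
      ∑ (listsOfLength (allSubsets m) L) (λ mid → when (does (isFlat? M a) ∧ does (a ⊂? x))
          (redCharPoly M a x *ₚ when (does (isFlagChain? (x ∷ mid ++ [ b ]))) (flagChainWeight (x ∷ mid ++ [ b ]))))
        ≈⟨ ∑-when (listsOfLength (allSubsets m) L) (does (isFlat? M a) ∧ does (a ⊂? x)) _ ⟩
      when (does (isFlat? M a) ∧ does (a ⊂? x)) (∑ (listsOfLength (allSubsets m) L) (λ mid →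
          redCharPoly M a x *ₚ when (does (isFlagChain? (x ∷ mid ++ [ b ]))) (flagChainWeight (x ∷ mid ++ [ b ]))))
        ≈⟨ when-cong (does (isFlat? M a) ∧ does (a ⊂? x)) (∑-*ₚˡ (listsOfLength (allSubsets m) L) (redCharPoly M a x) _) ⟩
      when (does (isFlat? M a) ∧ does (a ⊂? x)) (redCharPoly M a x *ₚ flagChainSum L x b) ∎

  flagChainSum-zero : ∀ {a b} → IsFlat M a → IsFlat M b → a ⊂ b → flagChainSum 0 a b ≈ redCharPoly M a b
  flagChainSum-zero {a} {b} flat-a flat-b a⊂b
    rewrite dec-true (isFlat? M a) flat-a | dec-true (isFlat? M b) flat-b | dec-true (a ⊂? b) a⊂b
    = ≈-trans (≈-reflexive (+ₚ-identityʳ _)) (*ₚ-identityʳ (redCharPoly M a b))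

  flagChainSum-none : ∀ L a b → (∀ mid → ¬ IsFlagChain M (a ∷ mid ++ [ b ])) → flagChainSum L a b ≈ 0ₚ
  flagChainSum-none L a b none = ∑-zero (listsOfLength (allSubsets m) L) λ mid →
    ≈-reflexive (cong (λ t → when t (flagChainWeight (a ∷ mid ++ [ b ]))) (dec-false (isFlagChain? (a ∷ mid ++ [ b ])) (none mid)))

  linked-⊂-ends : ∀ (c : Subset m) mid b → Linked _⊂_ (c ∷ mid ++ [ b ]) → c ⊂ b
  linked-⊂-ends c []        b (c⊂b ∷ _)    = c⊂b
  linked-⊂-ends c (x ∷ mid) b (c⊂x ∷ rest) = ⊂-trans c⊂x (linked-⊂-ends x mid b rest)

  flagChainSum-self : ∀ L c → flagChainSum L c c ≈ 0ₚ
  flagChainSum-self L c = flagChainSum-none L c c λ mid (_ , linked) → ⊂-irref refl (linked-⊂-ends c mid c linked)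

  flagChainSum-nonflat : ∀ L {c} b → ¬ IsFlat M c → flagChainSum L c b ≈ 0ₚ
  flagChainSum-nonflat L {c} b nonflat-c = flagChainSum-none L c b λ { mid ((flat-c ∷ _) , _) → nonflat-c flat-c }

  ∑-flagChainSum-suc : ∀ K {a} b → IsFlat M a →
    ∑ (upTo K) (λ L → flagChainSum (suc L) a b) ≈
    ∑ (allSubsets m) (λ x → when (does (a ⊂? x)) (redCharPoly M a x *ₚ ∑ (upTo K) (λ L → flagChainSum L x b)))
  ∑-flagChainSum-suc K {a} b flat-a = begin
    ∑ (upTo K) (λ L → flagChainSum (suc L) a b)
      ≈⟨ ∑-cong (upTo K) (λ L → flagChainSum-suc L a b) ⟩
    ∑ (upTo K) (λ L → ∑ (allSubsets m) λ x → when (does (isFlat? M a) ∧ does (a ⊂? x)) (redCharPoly M a x *ₚ flagChainSum L x b))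
      ≡⟨ cong (λ t → ∑ (upTo K) (λ L → ∑ (allSubsets m) λ x → when (t ∧ does (a ⊂? x)) (redCharPoly M a x *ₚ flagChainSum L x b)))
              (dec-true (isFlat? M a) flat-a) ⟩
    ∑ (upTo K) (λ L → ∑ (allSubsets m) λ x → when (does (a ⊂? x)) (redCharPoly M a x *ₚ flagChainSum L x b))
      ≈⟨ ∑-swap (upTo K) (allSubsets m) _ ⟩
    ∑ (allSubsets m) (λ x → ∑ (upTo K) λ L → when (does (a ⊂? x)) (redCharPoly M a x *ₚ flagChainSum L x b))
      ≈⟨ ∑-cong (allSubsets m) (λ x → ≈-trans (∑-when (upTo K) (does (a ⊂? x)) _)
                                              (when-cong (does (a ⊂? x)) (∑-*ₚˡ (upTo K) (redCharPoly M a x) _))) ⟩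
    ∑ (allSubsets m) (λ x → when (does (a ⊂? x)) (redCharPoly M a x *ₚ ∑ (upTo K) (λ L → flagChainSum L x b))) ∎
    where open ≈-Reasoning

module _ {m : ℕ} (M : Matroid m) {lab : Subset m → Subset m → ℕ} (R-labeling : IsRLabeling M lab) where

  maxChainSum-increasing≈1 : ∀ {c b} → IsFlat M c → IsFlat M b → c ⊂ b →
                             maxChainSum M lab c b (λ v → when (increasing v) 1ₚ) ≈ 1ₚ
  maxChainSum-increasing≈1 {c} {b} flat-c flat-b c⊂b with R-labeling c b flat-c flat-b c⊂b
  ... | _ , (((mid₀ , refl) , linked₀) , increasing₀) , unique = begin
    chainSum M lab (r M b ∸ r M c) c b W
      ≡⟨ cong (λ n → chainSum M lab n c b W) N≡ ⟩
    chainSum M lab (suc (length mid₀)) c b W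
      ≈⟨ chainSum-listsOfLength M lab (length mid₀) c b W ⟩
    ∑ (listsOfLength (allSubsets m) (length mid₀)) (λ mid → when (does (linked? (cover? M) (chain mid))) (W (labels M lab (chain mid))))
      ≈⟨ ∑-cong (listsOfLength (allSubsets m) (length mid₀)) (λ mid → ≈-reflexive (trans
           (sym (when-∧ (does (linked? (cover? M) (chain mid))) _ 1ₚ))
           (cong (λ t → when t 1ₚ) (does-⇔ (mk⇔ (to mid) (from mid))
              (linked? (cover? M) (chain mid) ×-dec linked? _≤?_ (labels M lab (chain mid))) (mid₀ ≟ₗ mid))))) ⟩
    ∑ (listsOfLength (allSubsets m) (length mid₀)) (λ mid → when (does (mid₀ ≟ₗ mid)) 1ₚ)
      ≈⟨ ∑-listsOfLength-≡ m (length mid₀) mid₀ (λ _ → 1ₚ) refl ⟩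
    1ₚ ∎
    where
    open ≈-Reasoning
    W : List ℕ → Poly
    W v = when (increasing v) 1ₚ
    chain : List (Subset m) → List (Subset m)
    chain mid = c ∷ mid ++ [ b ]
    N≡ : r M b ∸ r M c ≡ suc (length mid₀)
    N≡ = trans (cong (_∸ r M c) (r-coverChain M lab c mid₀ b linked₀)) (ℕP.m+n∸n≡m (suc (length mid₀)) (r M c))
    to : ∀ mid → Linked (Cover M) (chain mid) × WeaklyIncreasing M lab (chain mid) → mid₀ ≡ mid
    to mid (linked , inc) = sym (List.++-cancelʳ [ b ] mid mid₀ (List.∷-injectiveʳ (unique (chain mid) ((mid , refl) , linked) inc)))
    from : ∀ mid → mid₀ ≡ mid → Linked (Cover M) (chain mid) × WeaklyIncreasing M lab (chain mid)
    from mid refl = linked₀ , increasing₀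

  maxChainSum-increasing : ∀ Q {c b} → IsFlat M c → IsFlat M b → c ⊆ b →
                           maxChainSum M lab c b (increasingWeight Q) ≈ Q ^ₚ (r M b ∸ r M c)
  maxChainSum-increasing Q {c} {b} flat-c flat-b c⊆b with c ≟ₛ b
  ... | yes refl rewrite ℕP.n∸n≡0 (r M c) = ≈-reflexive (cong (λ t → when t 1ₚ) (dec-true (c ≟ₛ c) refl))
  ... | no  c≢b  = begin
    chainSum M lab N c b (increasingWeight Q)
      ≈⟨ chainSum-cong-length M lab N c b (λ v |v|≡N → ≈-trans (factor v) (≈-reflexive (cong (λ k → when (increasing v) 1ₚ *ₚ (Q ^ₚ k)) |v|≡N))) ⟩
    chainSum M lab N c b (λ v → when (increasing v) 1ₚ *ₚ (Q ^ₚ N))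
      ≈⟨ chainSum-*ₚʳ M lab N c b (Q ^ₚ N) (λ v → when (increasing v) 1ₚ) ⟩
    chainSum M lab N c b (λ v → when (increasing v) 1ₚ) *ₚ (Q ^ₚ N)
      ≈⟨ *ₚ-congʳ (Q ^ₚ N) (maxChainSum-increasing≈1 flat-c flat-b (⊆∧≢⇒⊂ c⊆b c≢b)) ⟩
    1ₚ *ₚ (Q ^ₚ N)
      ≈⟨ *ₚ-identityˡ (Q ^ₚ N) ⟩
    Q ^ₚ N ∎
    where
    open ≈-Reasoning
    N = r M b ∸ r M c
    factor : ∀ v → increasingWeight Q v ≈ when (increasing v) 1ₚ *ₚ (Q ^ₚ length v)
    factor v with increasing v
    ... | true  = ≈-sym (*ₚ-identityˡ (Q ^ₚ length v))
    ... | false = ≈-refl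

  maxChainSum-*ₚ-increasing : ∀ Q {a b} c U → IsFlat M a → IsFlat M b →
    maxChainSum M lab a c U *ₚ maxChainSum M lab c b (increasingWeight Q) ≈
    when (does (isFlat? M c)) (when (does (a ⊆? c) ∧ does (c ⊆? b)) (maxChainSum M lab a c U *ₚ (Q ^ₚ (r M b ∸ r M c))))
  maxChainSum-*ₚ-increasing Q {a} {b} c U flat-a flat-b = by-cases (isFlat? M c) (a ⊆? c) (c ⊆? b)
    where
    L = maxChainSum M lab a c U
    by-cases : (flat-c? : Dec (IsFlat M c)) (a⊆c? : Dec (a ⊆ c)) (c⊆b? : Dec (c ⊆ b)) →
               L *ₚ maxChainSum M lab c b (increasingWeight Q) ≈
               when (does flat-c?) (when (does a⊆c? ∧ does c⊆b?) (L *ₚ (Q ^ₚ (r M b ∸ r M c))))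
    by-cases (no nonflat-c) _ _ = *ₚ-absorbˡ L _ (chainSum-nonflat M lab (r M c ∸ r M a) a c U flat-a nonflat-c)
    by-cases (yes _) (no a⊈c) _ = *ₚ-absorbˡ L _ (chainSum-⊈ M lab (r M c ∸ r M a) a c U a⊈c)
    by-cases (yes _) (yes _) (no c⊈b) = *ₚ-absorbʳ L _ (chainSum-⊈ M lab (r M b ∸ r M c) c b (increasingWeight Q) c⊈b)
    by-cases (yes flat-c) (yes _) (yes c⊆b) = *ₚ-congˡ L (maxChainSum-increasing Q flat-c flat-b c⊆b)

  ∑-interval-möbiusWeight : ∀ {a b} → IsFlat M a → IsFlat M b → a ⊂ b →
    ∑ (allSubsets m) (λ c → when (does (isFlat? M c)) (when (does (a ⊆? c) ∧ does (c ⊆? b)) (maxChainSum M lab a c möbiusWeight))) ≈ 0ₚ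
  ∑-interval-möbiusWeight {a} {b} flat-a flat-b a⊂b = begin
    ∑ (allSubsets m) (λ c → when (does (isFlat? M c)) (when (does (a ⊆? c) ∧ does (c ⊆? b)) (maxChainSum M lab a c möbiusWeight)))
      ≈⟨ ∑-cong (allSubsets m) (λ c → ≈-sym (≈-trans (maxChainSum-*ₚ-increasing 1ₚ c möbiusWeight flat-a flat-b)
           (when-cong (does (isFlat? M c)) (when-cong (does (a ⊆? c) ∧ does (c ⊆? b))
              (≈-trans (*ₚ-congˡ (maxChainSum M lab a c möbiusWeight) (1ₚ^ₚ≈1ₚ (r M b ∸ r M c)))
                       (*ₚ-identityʳ (maxChainSum M lab a c möbiusWeight))))))) ⟩
    ∑ (allSubsets m) (λ c → maxChainSum M lab a c möbiusWeight *ₚ maxChainSum M lab c b (increasingWeight 1ₚ))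
      ≈⟨ maxChainSum-concat M lab a b möbiusWeight (increasingWeight 1ₚ) (ℕP.<⇒≤ (r-flat-⊂ M flat-a a⊂b)) ⟩
    maxChainSum M lab a b (splitSum (möbius⊗increasing 1ₚ))
      ≈⟨ maxChainSum-zero M lab a b (λ u |u|≡ → splitSum-möbius⊗increasing-at-1 u (maxChain-labels≢[] M flat-a a⊂b |u|≡)) ⟩
    0ₚ ∎
    where open ≈-Reasoning

  interval-split : ∀ {a b} c → IsFlat M b → a ⊆ b → ∀ p →
    when (does (isFlat? M c)) (when (does (a ⊆? c) ∧ does (c ⊆? b)) p) ≈
    when (does (isFlat? M c)) (when (does (a ⊆? c) ∧ does (c ⊂? b)) p) +ₚ when (does (c ≟ₛ b)) p
  interval-split {a} {b} c flat-b a⊆b p with c ≟ₛ b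
  ... | no c≢b = ≈-trans
    (≈-reflexive (cong (λ t → when (does (isFlat? M c)) (when (does (a ⊆? c) ∧ t) p))
                       (does-⇔ (≢⇒⊆⇔⊂ c≢b) (c ⊆? b) (c ⊂? b))))
    (≈-reflexive (sym (+ₚ-identityʳ _)))
  ... | yes refl
    rewrite dec-false (c ⊂? c) (⊂-irref refl) | dec-true (isFlat? M c) flat-b | dec-true (a ⊆? c) a⊆b | dec-true (c ⊆? c) id
    = ≈-refl

  maxChainSum-möbiusWeight-recursion : ∀ {a b} → IsFlat M a → IsFlat M b → a ⊂ b →
    maxChainSum M lab a b möbiusWeight ≈
    -ₚ ∑ (allSubsets m) (λ c → when (does (isFlat? M c)) (when (does (a ⊆? c) ∧ does (c ⊂? b)) (maxChainSum M lab a c möbiusWeight)))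
  maxChainSum-möbiusWeight-recursion {a} {b} flat-a flat-b a⊂b = inverseʳ-unique _ (D b) (begin
    below +ₚ D b
      ≈⟨ +ₚ-congˡ below (∑-allSubsets-≡ˡ m b D) ⟨
    below +ₚ ∑ (allSubsets m) (λ c → when (does (c ≟ₛ b)) (D c))
      ≈⟨ ∑-+ₚ (allSubsets m) _ _ ⟨
    ∑ (allSubsets m) (λ c → when (does (isFlat? M c)) (when (does (a ⊆? c) ∧ does (c ⊂? b)) (D c)) +ₚ when (does (c ≟ₛ b)) (D c))
      ≈⟨ ∑-cong (allSubsets m) (λ c → interval-split c flat-b (proj₁ a⊂b) (D c)) ⟨
    ∑ (allSubsets m) (λ c → when (does (isFlat? M c)) (when (does (a ⊆? c) ∧ does (c ⊆? b)) (D c)))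
      ≈⟨ ∑-interval-möbiusWeight flat-a flat-b a⊂b ⟩
    0ₚ ∎)
    where
    open ≈-Reasoning
    D : Subset m → Poly
    D c = maxChainSum M lab a c möbiusWeight
    below : Poly
    below = ∑ (allSubsets m) (λ c → when (does (isFlat? M c)) (when (does (a ⊆? c) ∧ does (c ⊂? b)) (D c)))

  möbius≈maxChainSum : ∀ f {a b} → IsFlat M a → IsFlat M b → a ⊆ b → r M b ∸ r M a < f →
                       möbiusFuel M f a b ∷ [] ≈ maxChainSum M lab a b möbiusWeight
  möbius≈maxChainSum (suc f) {a} {b} flat-a flat-b a⊆b fuel with a ≟ₛ b
  ... | yes refl rewrite ℕP.n∸n≡0 (r M a) = ≈-reflexive (cong (λ t → when t (+ 1 ∷ [])) (sym (dec-true (a ≟ₛ a) refl)))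
  ... | no a≢b with a ⊆? b
  ...   | no a⊈b = contradiction (λ {x} → a⊆b {x}) a⊈b
  ...   | yes _  = begin
    -ₚ (sumℤ (map (möbiusFuel M f a) (filter P? (flats M))) ∷ [])
      ≈⟨ -ₚ-cong (≈-trans (sumℤ-∑ (filter P? (flats M)) (möbiusFuel M f a))
                          (≈-trans (∑-filter P? (flats M) _) (∑-filter (isFlat? M) (allSubsets m) _))) ⟩
    -ₚ ∑ (allSubsets m) (λ c → when (does (isFlat? M c)) (when (does (P? c)) (möbiusFuel M f a c ∷ [])))
      ≈⟨ -ₚ-cong (∑-cong (allSubsets m) λ c → when-dec-cong (isFlat? M c) λ flat-c → when-dec-cong (P? c) λ (a⊆c , c⊂b) →
           möbius≈maxChainSum f flat-a flat-c a⊆c (ℕP.<-≤-trans (ℕP.∸-monoˡ-< (r-flat-⊂ M flat-c c⊂b) (r-mono M a⊆c)) (ℕP.≤-pred fuel))) ⟩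
    -ₚ ∑ (allSubsets m) (λ c → when (does (isFlat? M c)) (when (does (P? c)) (maxChainSum M lab a c möbiusWeight)))
      ≈⟨ maxChainSum-möbiusWeight-recursion flat-a flat-b (⊆∧≢⇒⊂ a⊆b a≢b) ⟨
    maxChainSum M lab a b möbiusWeight ∎
    where
    open ≈-Reasoning
    P? : ∀ c → Dec (a ⊆ c × c ⊂ b)
    P? c = (a ⊆? c) ×-dec (c ⊂? b)

  charPoly≈ : ∀ {a b} → IsFlat M a → IsFlat M b → a ⊂ b →
              charPoly M a b ≈ X-1 *ₚ maxChainSum M lab a b (redCharWeight X)
  charPoly≈ {a} {b} flat-a flat-b a⊂b = begin
    ∑ (filter P? (flats M)) (λ c → monomial (μ M a c) (r M b ∸ r M c))
      ≈⟨ ≈-trans (∑-filter P? (flats M) _) (∑-filter (isFlat? M) (allSubsets m) _) ⟩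
    ∑ (allSubsets m) (λ c → when (does (isFlat? M c)) (when (does (P? c)) (monomial (μ M a c) (r M b ∸ r M c))))
      ≈⟨ ∑-cong (allSubsets m) (λ c → when-dec-cong (isFlat? M c) λ flat-c → when-dec-cong (P? c) λ (a⊆c , _) →
           ≈-trans (monomial≈ (μ M a c) (r M b ∸ r M c))
                   (*ₚ-congʳ (X ^ₚ (r M b ∸ r M c)) (möbius≈maxChainSum (suc m) flat-a flat-c a⊆c
                      (s≤s (ℕP.≤-trans (ℕP.m∸n≤m (r M c) (r M a)) (r≤m M c)))))) ⟩
    ∑ (allSubsets m) (λ c → when (does (isFlat? M c)) (when (does (P? c)) (maxChainSum M lab a c möbiusWeight *ₚ (X ^ₚ (r M b ∸ r M c)))))
      ≈⟨ ∑-cong (allSubsets m) (λ c → maxChainSum-*ₚ-increasing X c möbiusWeight flat-a flat-b) ⟨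
    ∑ (allSubsets m) (λ c → maxChainSum M lab a c möbiusWeight *ₚ maxChainSum M lab c b (increasingWeight X))
      ≈⟨ maxChainSum-concat M lab a b möbiusWeight (increasingWeight X) (ℕP.<⇒≤ (r-flat-⊂ M flat-a a⊂b)) ⟩
    maxChainSum M lab a b (splitSum (möbius⊗increasing X))
      ≈⟨ maxChainSum-cong M lab a b (λ u |u|≡ → splitSum-möbius⊗increasing X u (maxChain-labels≢[] M flat-a a⊂b |u|≡)) ⟩
    maxChainSum M lab a b (λ ℓ → X-1 *ₚ redCharWeight X ℓ)
      ≈⟨ maxChainSum-*ₚˡ M lab a b X-1 (redCharWeight X) ⟩
    X-1 *ₚ maxChainSum M lab a b (redCharWeight X) ∎
    where
    open ≈-Reasoning
    P? : ∀ c → Dec (a ⊆ c × c ⊆ b)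
    P? c = (a ⊆? c) ×-dec (c ⊆? b)

  redCharPoly≈ : ∀ {a b} → IsFlat M a → IsFlat M b → a ⊂ b →
                 redCharPoly M a b ≈ maxChainSum M lab a b (redCharWeight X)
  redCharPoly≈ flat-a flat-b a⊂b = divByQ-1-correct _ _ (charPoly≈ flat-a flat-b a⊂b)

  flagChainSum-first-step : ∀ K {a} x → IsFlat M a → a ⊂ ⊤ →
    (∀ {y} → IsFlat M y → a ⊂ y → y ⊂ ⊤ → ∑ (upTo K) (λ L → flagChainSum M L y ⊤) ≈ maxChainSum M lab y ⊤ descentWeight) →
    when (does (x ≟ₛ ⊤)) (flagChainSum M 0 a x) +ₚ when (does (a ⊂? x)) (redCharPoly M a x *ₚ ∑ (upTo K) (λ L → flagChainSum M L x ⊤))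
      ≈ maxChainSum M lab a x (redCharWeight X) *ₚ maxChainSum M lab x ⊤ descentWeight
  flagChainSum-first-step K {a} x flat-a a⊂⊤ IH = by-cases (x ≟ₛ ⊤) (a ⊂? x) (isFlat? M x)
    where
    open ≈-Reasoning
    S : Subset m → Poly
    S y = ∑ (upTo K) (λ L → flagChainSum M L y ⊤)
    by-cases : (x≟⊤ : Dec (x ≡ ⊤)) (a⊂x? : Dec (a ⊂ x)) (flat-x? : Dec (IsFlat M x)) →
      when (does x≟⊤) (flagChainSum M 0 a x) +ₚ when (does a⊂x?) (redCharPoly M a x *ₚ S x) ≈
      maxChainSum M lab a x (redCharWeight X) *ₚ maxChainSum M lab x ⊤ descentWeight
    by-cases (yes refl) (no a⊄⊤) _ = contradiction a⊂⊤ a⊄⊤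
    by-cases (yes refl) (yes _)  _ = begin
      flagChainSum M 0 a ⊤ +ₚ (redCharPoly M a ⊤ *ₚ S ⊤)
        ≈⟨ +ₚ-cong (flagChainSum-zero M flat-a (flat-⊤ M) a⊂⊤)
                   (*ₚ-absorbʳ (redCharPoly M a ⊤) (S ⊤) (∑-zero (upTo K) λ L → flagChainSum-self M L ⊤)) ⟩
      redCharPoly M a ⊤ +ₚ 0ₚ
        ≡⟨ +ₚ-identityʳ _ ⟩
      redCharPoly M a ⊤
        ≈⟨ redCharPoly≈ flat-a (flat-⊤ M) a⊂⊤ ⟩
      maxChainSum M lab a ⊤ (redCharWeight X)
        ≈⟨ *ₚ-identityʳ _ ⟨
      maxChainSum M lab a ⊤ (redCharWeight X) *ₚ 1ₚ
        ≈⟨ *ₚ-congˡ (maxChainSum M lab a ⊤ (redCharWeight X)) (maxChainSum-self M lab ⊤ descentWeight) ⟨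
      maxChainSum M lab a ⊤ (redCharWeight X) *ₚ maxChainSum M lab ⊤ ⊤ descentWeight ∎
    by-cases (no x≢⊤) (no a⊄x) _ with a ⊆? x | a ≟ₛ x
    ... | no a⊈x | _        = ≈-sym (*ₚ-absorbˡ _ _ (chainSum-⊈ M lab (r M x ∸ r M a) a x (redCharWeight X) a⊈x))
    ... | yes _  | yes refl = ≈-sym (*ₚ-absorbˡ _ _ (maxChainSum-self M lab a (redCharWeight X)))
    ... | yes a⊆x | no a≢x  = contradiction (⊆∧≢⇒⊂ a⊆x a≢x) a⊄x
    by-cases (no x≢⊤) (yes a⊂x) (no nonflat-x) = ≈-trans
      (*ₚ-absorbʳ (redCharPoly M a x) (S x) (∑-zero (upTo K) λ L → flagChainSum-nonflat M L ⊤ nonflat-x))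
      (≈-sym (*ₚ-absorbˡ _ _ (chainSum-nonflat M lab (r M x ∸ r M a) a x (redCharWeight X) flat-a nonflat-x)))
    by-cases (no x≢⊤) (yes a⊂x) (yes flat-x) =
      *ₚ-cong (redCharPoly≈ flat-a flat-x a⊂x) (IH flat-x a⊂x (⊆∧≢⇒⊂ ⊆⊤ x≢⊤))

  -- K bounds the number of flats strictly between a and ⊤; x runs over the first of them.
  flagChainSums≈maxChainSum : ∀ K {a} → IsFlat M a → a ⊂ ⊤ → r M ⊤ ∸ r M a ≤ K →
    ∑ (upTo K) (λ L → flagChainSum M L a ⊤) ≈ maxChainSum M lab a ⊤ descentWeight
  flagChainSums≈maxChainSum zero    flat-a a⊂⊤ N≤0 =
    contradiction (ℕP.m∸n≡0⇒m≤n (ℕP.n≤0⇒n≡0 N≤0)) (ℕP.<⇒≱ (r-flat-⊂ M flat-a a⊂⊤))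
  flagChainSums≈maxChainSum (suc K) {a} flat-a a⊂⊤ N≤K = begin
    ∑ (upTo (suc K)) (λ L → flagChainSum M L a ⊤)
      ≈⟨ ∑-upTo-suc K (λ L → flagChainSum M L a ⊤) ⟩
    flagChainSum M 0 a ⊤ +ₚ ∑ (upTo K) (λ L → flagChainSum M (suc L) a ⊤)
      ≈⟨ +ₚ-cong (≈-sym (∑-allSubsets-≡ˡ m ⊤ (flagChainSum M 0 a))) (∑-flagChainSum-suc M K ⊤ flat-a) ⟩
    ∑ (allSubsets m) (λ x → when (does (x ≟ₛ ⊤)) (flagChainSum M 0 a x)) +ₚ
    ∑ (allSubsets m) (λ x → when (does (a ⊂? x)) (redCharPoly M a x *ₚ ∑ (upTo K) (λ L → flagChainSum M L x ⊤)))
      ≈⟨ ∑-+ₚ (allSubsets m) _ _ ⟨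
    ∑ (allSubsets m) (λ x → when (does (x ≟ₛ ⊤)) (flagChainSum M 0 a x) +ₚ
                            when (does (a ⊂? x)) (redCharPoly M a x *ₚ ∑ (upTo K) (λ L → flagChainSum M L x ⊤)))
      ≈⟨ ∑-cong (allSubsets m) (λ x → flagChainSum-first-step K x flat-a a⊂⊤ λ flat-x a⊂x x⊂⊤ →
           flagChainSums≈maxChainSum K flat-x x⊂⊤
             (ℕP.≤-pred (ℕP.<-≤-trans (ℕP.∸-monoʳ-< (r-flat-⊂ M flat-a a⊂x) (r-mono M ⊆⊤)) N≤K))) ⟩
    ∑ (allSubsets m) (λ x → maxChainSum M lab a x (redCharWeight X) *ₚ maxChainSum M lab x ⊤ descentWeight)
      ≈⟨ maxChainSum-concat M lab a ⊤ (redCharWeight X) descentWeight (ℕP.<⇒≤ (r-flat-⊂ M flat-a a⊂⊤)) ⟩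
    maxChainSum M lab a ⊤ (splitSum redChar⊗descent)
      ≈⟨ maxChainSum-cong M lab a ⊤ (λ u |u|≡ → splitSum-redChar⊗descent u (maxChain-labels≢[] M flat-a a⊂⊤ |u|≡)) ⟩
    maxChainSum M lab a ⊤ descentWeight ∎
    where open ≈-Reasoning

theorem1p1 : (m : ℕ) (M : Matroid m) → Loopless M → 1 ≤ rank M →
             (lab : Subset m → Subset m → ℕ) → IsRLabeling M lab →
             chowPoly M ≈ₚ descentSum M lab
theorem1p1 m M loopless 1≤rank lab R-labeling = coeff-≡ (begin
  chowPoly M                                     ≈⟨ chowPoly≈ M ⟩
  ∑ (upTo (suc m)) (λ L → flagChainSum M L ⊥ ⊤)  ≈⟨ flagChainSums≈maxChainSum M R-labeling (suc m) (flat-⊥ M loopless) ⊥⊂⊤ N≤1+m ⟩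
  maxChainSum M lab ⊥ ⊤ descentWeight            ≈⟨ descentSum≈maxChainSum M lab 1≤rank ⟨
  descentSum M lab                               ∎)
  where
  open ≈-Reasoning
  ⊥⊂⊤ : ⊥ ⊂ ⊤
  ⊥⊂⊤ = ⊆⊤ , fromℕ< (ℕP.<-≤-trans 1≤rank (r≤m M ⊤)) , ∈⊤ , ∉⊥
  N≤1+m : r M ⊤ ∸ r M ⊥ ≤ suc m
  N≤1+m = ℕP.≤-trans (ℕP.m∸n≤m (r M ⊤) (r M ⊥)) (ℕP.m≤n⇒m≤1+n (r≤m M ⊤))
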